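{- Let $G$ be a finite $2$-group such that $G/G'$ has rank $3$. Suppose $H_1,H_2,H_3$ are distinct maximal subgroups of $G$ with $H_1\cap H_2\subseteq H_3$ and such that $H_j'=G'$ for $j=1,2,3$. Then $G'=1$, and hence $H'=G'$ for all subgroups $H$ of $G$. Conversely, if $G'=1$ then $H'=G'$ for all subgroups $H$ of $G$.
   Context: $G'$ denotes the commutator subgroup of $G$; the rank of a finite abelian group is its minimal number of generators. -}

module Defs where

open import Data.Nat using (ℕ; _^_; _<_)
open import Data.Fin using (Fin)
open import Data.Fin.Subset using (Subset; _∈_; _∉_)
open import Data.Product using (Σ; ∃; ∃-syntax; _×_)
open import Data.Sum using (_⊎_)
open import Relation.Nullary using (¬_)
open import Relation.Binary.PropositionalEquality using (_≡_)

record FinGroup : Set where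
  field
    order     : ℕ
    _∙_       : Fin order → Fin order → Fin order
    ε         : Fin order
    _⁻¹       : Fin order → Fin order
    assoc     : ∀ x y z → (x ∙ y) ∙ z ≡ x ∙ (y ∙ z)
    identityˡ : ∀ x → ε ∙ x ≡ x
    identityʳ : ∀ x → x ∙ ε ≡ x
    inverseˡ  : ∀ x → (x ⁻¹) ∙ x ≡ ε
    inverseʳ  : ∀ x → x ∙ (x ⁻¹) ≡ ε

module _ (G : FinGroup) where
  open FinGroup G

  El : Set
  El = Fin order

  SetOf : Set₁
  SetOf = El → Set

  _⊆_ : SetOf → SetOf → Set
  A ⊆ B = ∀ x → A x → B x

  _≐_ : SetOf → SetOf → Set
  A ≐ B = (A ⊆ B) × (B ⊆ A)

  Is2Group : Set
  Is2Group = ∃[ k ] order ≡ 2 ^ k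

  IsSubgroup : Subset order → Set
  IsSubgroup H = (ε ∈ H) × (∀ x y → x ∈ H → y ∈ H → (x ∙ y) ∈ H)
                 × (∀ x → x ∈ H → (x ⁻¹) ∈ H)

  mem : Subset order → SetOf
  mem H x = x ∈ H

  IsMaximalSubgroup : Subset order → Set
  IsMaximalSubgroup H = IsSubgroup H × (∃[ x ] x ∉ H)
    × (∀ K → IsSubgroup K → mem H ⊆ mem K → (mem K ⊆ mem H) ⊎ (∀ x → x ∈ K))

  data ⟨_⟩ (S : SetOf) : SetOf where
    gen : ∀ {x} → S x → ⟨ S ⟩ x
    one : ⟨ S ⟩ ε
    mul : ∀ {x y} → ⟨ S ⟩ x → ⟨ S ⟩ y → ⟨ S ⟩ (x ∙ y)
    inv : ∀ {x} → ⟨ S ⟩ x → ⟨ S ⟩ (x ⁻¹)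

  [_,_] : El → El → El
  [ a , b ] = ((a ⁻¹) ∙ (b ⁻¹)) ∙ (a ∙ b)

  derived : SetOf → SetOf
  derived A = ⟨ (λ z → ∃[ a ] ∃[ b ] A a × A b × z ≡ [ a , b ]) ⟩

  whole : SetOf
  whole _ = ⊤' where open import Data.Unit using () renaming (⊤ to ⊤')

  G′ : SetOf
  G′ = derived whole

  G′trivial : Set
  G′trivial = ∀ x → G′ x → x ≡ ε

  -- the images of g₁..g_d generate G/G', i.e. ⟨g₁,…,g_d⟩G' = G
  GeneratesAbelianization : (d : ℕ) → (Fin d → El) → Set
  GeneratesAbelianization d g =
    ∀ x → ⟨ (λ z → (∃[ i ] z ≡ g i) ⊎ G′ z) ⟩ x

  AbelianizationRank : ℕ → Set
  AbelianizationRank r = (∃[ g ] GeneratesAbelianization r g)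
    × (∀ d → d < r → ∀ g → ¬ GeneratesAbelianization d g)

{-# OPTIONS --safe #-}

-- Suppose G′ ≠ 1. Counting fixed points of 2-groups acting on sets of even size shows that the
-- maximal subgroups of G are normal of index 2, and produces a normal subgroup M of G inside G′
-- with |G′ : M| = 2. Then β(x, y) = [x, y] M ∈ G′/M ≅ F₂ is alternating and bilinear, and since
-- G/G′ is generated by three elements, β and every homomorphism G → F₂ are computed from
-- coordinates in F₂³. Each Hᵢ is the kernel of a nonzero functional fᵢ; distinctness and
-- H₁ ∩ H₂ ⊆ H₃ force f₃ = f₁ + f₂, and Hᵢ′ = G′ ⊄ M says that β does not vanish on ker fᵢ.
-- But a nonzero alternating form on F₂³ vanishes exactly on the planes containing its radical
-- ⟨r⟩, so f₁(r) = f₂(r) = 1 and hence f₃(r) = 0, a contradiction.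

module Submission where

open import Defs

open import Algebra.Bundles using (Group)
import Algebra.Properties.Group as GroupProperties
import Data.Nat.Properties as ℕ
open import Algebra.Properties.Semiring.Sum ℕ.+-*-semiring
  using (sum-syntax; ∑-comm; ∑-distrib-+; *-distribʳ-sum; sum-cong-≗; sum-replicate-zero)
open import Data.Bool using (Bool; true; false; not; _∧_; _xor_; if_then_else_)
import Data.Bool.Properties as Bool
open import Data.Bool.Solver using (module xor-∧-Solver)
open import Data.Empty using (⊥-elim)
open import Data.Fin using (Fin; zero; suc; _≟_; toℕ)
open import Data.Fin.Properties using (any?; all?; suc-injective; pigeonhole)
open import Data.Fin.Subset using (Subset; _∈_; _∉_)
open import Data.Fin.Subset.Properties using (_∈?_)
open import Data.Nat using (ℕ; zero; suc; _+_; _∸_; _*_; _^_; _≤_; _<_; z≤n; s≤s)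
open import Data.Nat.Divisibility using (_∣_; divides; ∣1⇒≡1; ∣-trans; ∣m∣n⇒∣m+n; ∣m+n∣m⇒∣n)
open import Data.Nat.Primality using (euclidsLemma; prime[2])
open import Data.Product using (Σ; ∃; ∃-syntax; _×_; _,_; proj₁; proj₂)
open import Data.Product.Properties using (≡-dec)
open import Data.Sum using (_⊎_; inj₁; inj₂; [_,_]′)
open import Data.Unit using (⊤; tt)
open import Data.Vec using (tabulate)
open import Data.Vec.Properties using ([]=⇒lookup; lookup⇒[]=; lookup∘tabulate)
open import Function using (_∘_)
open import Level using (0ℓ)
open import Relation.Binary.PropositionalEquality
  using (_≡_; _≢_; refl; sym; trans; cong; cong₂; subst; isEquivalence; module ≡-Reasoning)
open import Relation.Binary.Structures using (IsDecEquivalence)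
open import Relation.Nullary using (¬_; Dec; yes; no; does; contradiction)
open import Relation.Nullary.Decidable
  using (_×-dec_; _⊎-dec_; _→-dec_; ¬?; map′; decidable-stable; dec-true; dec-false; from-yes)
open import Relation.Unary using (Decidable)
open import Relation.Unary.Properties using (_∩?_; _∪?_)

∣2^⇒≡1⊎2∣ : ∀ j {a} → a ∣ 2 ^ j → a ≡ 1 ⊎ 2 ∣ a
∣2^⇒≡1⊎2∣ zero a∣1 = inj₁ (∣1⇒≡1 a∣1)
∣2^⇒≡1⊎2∣ (suc j) {a} (divides q 2^j+1≡q*a)
  with euclidsLemma q a prime[2] (divides (2 ^ j) (trans (sym 2^j+1≡q*a) (ℕ.*-comm 2 (2 ^ j))))
... | inj₂ 2∣a = inj₂ 2∣a
... | inj₁ (divides r refl) = ∣2^⇒≡1⊎2∣ j (divides r (ℕ.*-cancelˡ-≡ (2 ^ j) (r * a) 2 2^j+1≡2*r*a))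
  where
  2^j+1≡2*r*a : 2 * 2 ^ j ≡ 2 * (r * a)
  2^j+1≡2*r*a = trans 2^j+1≡q*a (trans (cong (_* a) (ℕ.*-comm r 2)) (ℕ.*-assoc 2 r a))

bounded-ascent : ∀ {a p} {A : Set a} {P : A → Set p} (size : A → ℕ) (bound : ℕ) →
                 (∀ x → size x ≤ bound) → (∀ x → P x ⊎ ∃[ y ] size x < size y) → A → Σ A P
bounded-ascent {A = A} {P} size bound size≤bound step x₀ = go (suc bound) x₀ (ℕ.m≤m+n (suc bound) (size x₀))
  where
  go : ∀ fuel x → bound < fuel + size x → Σ A P
  go zero x b<s = contradiction (size≤bound x) (ℕ.<⇒≱ b<s)
  go (suc fuel) x b<fuel+s with step x
  ... | inj₁ px = x , px
  ... | inj₂ (y , sx<sy) = go fuel y (ℕ.≤-trans b<fuel+s fuel+1+sx≤fuel+sy)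
    where
    fuel+1+sx≤fuel+sy : suc fuel + size x ≤ fuel + size y
    fuel+1+sx≤fuel+sy = ℕ.≤-trans (ℕ.≤-reflexive (sym (ℕ.+-suc fuel (size x)))) (ℕ.+-monoʳ-≤ fuel sx<sy)

indicator : ∀ {A : Set} → Dec A → ℕ
indicator a? = if does a? then 1 else 0

indicator-mono : ∀ {A B : Set} → (A → B) → (a? : Dec A) (b? : Dec B) → indicator a? ≤ indicator b?
indicator-mono f (yes a) (yes b) = ℕ.≤-refl
indicator-mono f (yes a) (no ¬b) = contradiction (f a) ¬b
indicator-mono f (no ¬a) b?      = z≤n

indicator-cong : ∀ {A B : Set} → (A → B) → (B → A) → (a? : Dec A) (b? : Dec B) → indicator a? ≡ indicator b?
indicator-cong f g a? b? = ℕ.≤-antisym (indicator-mono f a? b?) (indicator-mono g b? a?)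

indicator-no : ∀ {A : Set} (a? : Dec A) → ¬ A → indicator a? ≡ 0
indicator-no (yes a) ¬a = contradiction a ¬a
indicator-no (no _)  ¬a = refl

count : ∀ {n} {P : Fin n → Set} → Decidable P → ℕ
count {n} P? = ∑[ i < n ] indicator (P? i)

count-cong : ∀ {n} {P Q : Fin n → Set} (P? : Decidable P) (Q? : Decidable Q) →
             (∀ {i} → P i → Q i) → (∀ {i} → Q i → P i) → count P? ≡ count Q?
count-cong P? Q? P⇒Q Q⇒P = sum-cong-≗ (λ i → indicator-cong P⇒Q Q⇒P (P? i) (Q? i))

count-≤ : ∀ {n} {P : Fin n → Set} (P? : Decidable P) → count P? ≤ n
count-≤ {zero}  P? = z≤n
count-≤ {suc n} P? = ℕ.+-mono-≤ (indicator-mono (λ _ → tt) (P? zero) (yes tt)) (count-≤ (P? ∘ suc))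

count-mono : ∀ {n} {P Q : Fin n → Set} (P? : Decidable P) (Q? : Decidable Q) →
             (∀ {i} → P i → Q i) → count P? ≤ count Q?
count-mono {zero}  P? Q? P⇒Q = z≤n
count-mono {suc n} P? Q? P⇒Q =
  ℕ.+-mono-≤ (indicator-mono P⇒Q (P? zero) (Q? zero)) (count-mono (P? ∘ suc) (Q? ∘ suc) P⇒Q)

count-mono-< : ∀ {n} {P Q : Fin n → Set} (P? : Decidable P) (Q? : Decidable Q) →
               (∀ {i} → P i → Q i) → ∀ {i} → ¬ P i → Q i → count P? < count Q?
count-mono-< P? Q? P⇒Q {zero} ¬Pi Qi with P? zero | Q? zero
... | yes Pi | _       = contradiction Pi ¬Pi
... | no _   | no ¬Qi  = contradiction Qi ¬Qi
... | no _   | yes _   = s≤s (count-mono (P? ∘ suc) (Q? ∘ suc) P⇒Q)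
count-mono-< P? Q? P⇒Q {suc i} ¬Pi Qi =
  ℕ.+-mono-≤-< (indicator-mono P⇒Q (P? zero) (Q? zero)) (count-mono-< (P? ∘ suc) (Q? ∘ suc) P⇒Q ¬Pi Qi)

count-∅ : ∀ {n} {P : Fin n → Set} (P? : Decidable P) → (∀ i → ¬ P i) → count P? ≡ 0
count-∅ {n} P? ∄P = trans (sum-cong-≗ (λ i → indicator-no (P? i) (∄P i))) (sum-replicate-zero n)

count-singleton : ∀ {n} {P : Fin n → Set} (P? : Decidable P) {a} → P a → (∀ {i} → P i → i ≡ a) →
                  count P? ≡ 1
count-singleton P? {zero} Pa unique with P? zero
... | no ¬P0 = contradiction Pa ¬P0
... | yes _  = cong suc (count-∅ (P? ∘ suc) (λ i Psi → contradiction (unique Psi) λ ()))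
count-singleton P? {suc a} Pa unique with P? zero
... | yes P0 = contradiction (unique P0) λ ()
... | no _   = count-singleton (P? ∘ suc) Pa (suc-injective ∘ unique)

count≡1⇒unique : ∀ {n} {P : Fin n → Set} (P? : Decidable P) → count P? ≡ 1 →
                 ∀ {a b} → P a → P b → a ≡ b
count≡1⇒unique P? count≡1 {a} {b} Pa Pb with b ≟ a
... | yes b≡a = sym b≡a
... | no b≢a  = contradiction (subst (_< count P?) count-≡a count-≡a<count-P) (ℕ.<-irrefl (sym count≡1))
  where
  count-≡a : count (_≟ a) ≡ 1
  count-≡a = count-singleton (_≟ a) refl (λ i≡a → i≡a)
  count-≡a<count-P : count (_≟ a) < count P?
  count-≡a<count-P = count-mono-< (_≟ a) P? (λ { refl → Pa }) b≢a Pb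

2∣count⇒∃≢ : ∀ {n} {P : Fin n → Set} (P? : Decidable P) → 2 ∣ count P? →
             ∀ {a} → P a → ∃[ b ] P b × b ≢ a
2∣count⇒∃≢ {P = P} P? 2∣count {a} Pa with any? (λ b → P? b ×-dec ¬? (b ≟ a))
... | yes (b , Pb , b≢a) = b , Pb , b≢a
... | no ∄b = contradiction (subst (2 ∣_) count≡1 2∣count) λ 2∣1 → contradiction (∣1⇒≡1 2∣1) λ ()
  where
  P⇒≡a : ∀ {i} → P i → i ≡ a
  P⇒≡a {i} Pi with i ≟ a
  ... | yes i≡a = i≡a
  ... | no i≢a  = contradiction (i , Pi , i≢a) ∄b
  count≡1 : count P? ≡ 1
  count≡1 = count-singleton P? Pa P⇒≡a

∑-even : ∀ {m} (h : Fin m → ℕ) → (∀ y → 2 ∣ h y) → 2 ∣ ∑[ y < m ] h y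
∑-even {zero}  h 2∣h = divides 0 refl
∑-even {suc m} h 2∣h = ∣m∣n⇒∣m+n (2∣h zero) (∑-even (h ∘ suc) (2∣h ∘ suc))

module Fibres {n m : ℕ} {P : Fin n → Set} (P? : Decidable P) (f : Fin n → Fin m) where

  Fibre : Fin m → Fin n → Set
  Fibre y x = P x × f x ≡ y

  fibre? : ∀ y → Decidable (Fibre y)
  fibre? y x = P? x ×-dec (f x ≟ y)

  count-fibres : count P? ≡ ∑[ y < m ] count (fibre? y)
  count-fibres = trans (sum-cong-≗ fibres-of) (∑-comm (λ x y → indicator (fibre? y x)))
    where
    indicator≡count : ∀ {A : Set} (a? : Dec A) z → indicator a? ≡ count (λ y → a? ×-dec (z ≟ y))
    indicator≡count (yes a) z = sym (count-singleton (λ y → yes a ×-dec (z ≟ y)) (a , refl) (sym ∘ proj₂))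
    indicator≡count (no ¬a) z = sym (count-∅ (λ y → no ¬a ×-dec (z ≟ y)) (λ y → ¬a ∘ proj₁))
    fibres-of : ∀ x → indicator (P? x) ≡ count (λ y → fibre? y x)
    fibres-of x = indicator≡count (P? x) (f x)

  count-fibres-const : {Q : Fin m → Set} (Q? : Decidable Q) (c : ℕ) →
                       (∀ {y} → Q y → count (fibre? y) ≡ c) → (∀ {y} → ¬ Q y → count (fibre? y) ≡ 0) →
                       count P? ≡ count Q? * c
  count-fibres-const Q? c over-Q outside-Q = begin
    count P?                             ≡⟨ count-fibres ⟩
    ∑[ y < m ] count (fibre? y)          ≡⟨ sum-cong-≗ fibre-size ⟩
    ∑[ y < m ] (indicator (Q? y) * c)    ≡⟨ *-distribʳ-sum c (indicator ∘ Q?) ⟨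
    count Q? * c                         ∎
    where
    open ≡-Reasoning
    fibre-size : ∀ y → count (fibre? y) ≡ indicator (Q? y) * c
    fibre-size y with Q? y
    ... | yes Qy = trans (over-Q Qy) (sym (ℕ.+-identityʳ c))
    ... | no ¬Qy = outside-Q ¬Qy

  count-fibres-parity : {Q : Fin m → Set} (Q? : Decidable Q) →
                        (∀ {y} → Q y → count (fibre? y) ≡ 1) → (∀ {y} → ¬ Q y → 2 ∣ count (fibre? y)) →
                        2 ∣ count P? → 2 ∣ count Q?
  count-fibres-parity Q? over-Q outside-Q 2∣P = ∣m+n∣m⇒∣n 2∣fibres+Q (subst (2 ∣_) count-fibres 2∣P)
    where
    fibre+indicator : ∀ y → 2 ∣ count (fibre? y) + indicator (Q? y)
    fibre+indicator y with Q? y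
    ... | yes Qy = subst (λ c → 2 ∣ c + 1) (sym (over-Q Qy)) (divides 1 refl)
    ... | no ¬Qy = subst (2 ∣_) (sym (ℕ.+-identityʳ _)) (outside-Q ¬Qy)
    2∣fibres+Q : 2 ∣ ∑[ y < m ] count (fibre? y) + count Q?
    2∣fibres+Q = subst (2 ∣_) (∑-distrib-+ (count ∘ fibre?) (indicator ∘ Q?)) (∑-even _ fibre+indicator)

count-bij : ∀ {n} {P Q : Fin n → Set} (P? : Decidable P) (Q? : Decidable Q) (f g : Fin n → Fin n) →
            (∀ {x} → P x → Q (f x)) → (∀ {y} → Q y → P (g y)) →
            (∀ {x} → P x → g (f x) ≡ x) → (∀ {y} → Q y → f (g y) ≡ y) → count P? ≡ count Q?
count-bij {Q = Q} P? Q? f g f∈Q g∈P g∘f f∘g =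
  trans (count-fibres-const Q? 1 single-preimage no-preimage) (ℕ.*-identityʳ _)
  where
  open Fibres P? f
  single-preimage : ∀ {y} → Q y → count (fibre? y) ≡ 1
  single-preimage Qy = count-singleton (fibre? _) (g∈P Qy , f∘g Qy) λ { (Px , refl) → sym (g∘f Px) }
  no-preimage : ∀ {y} → ¬ Q y → count (fibre? y) ≡ 0
  no-preimage ¬Qy = count-∅ (fibre? _) λ { x (Px , refl) → ¬Qy (f∈Q Px) }

least : ∀ {n} {P : Fin n → Set} → Decidable P → ∀ a → P a → Fin n
least P? zero    Pa = zero
least P? (suc a) Pa with P? zero
... | yes _ = zero
... | no  _ = suc (least (P? ∘ suc) a Pa)

least-holds : ∀ {n} {P : Fin n → Set} (P? : Decidable P) a (Pa : P a) → P (least P? a Pa)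
least-holds P? zero    Pa = Pa
least-holds P? (suc a) Pa with P? zero
... | yes P0 = P0
... | no  _  = least-holds (P? ∘ suc) a Pa

least-cong : ∀ {n} {P Q : Fin n → Set} (P? : Decidable P) (Q? : Decidable Q) →
             (∀ {i} → P i → Q i) → (∀ {i} → Q i → P i) →
             ∀ a b (Pa : P a) (Qb : Q b) → least P? a Pa ≡ least Q? b Qb
least-cong P? Q? P⇒Q Q⇒P zero zero Pa Qb = refl
least-cong P? Q? P⇒Q Q⇒P zero (suc b) Pa Qb with Q? zero
... | yes _   = refl
... | no ¬Q0  = contradiction (P⇒Q Pa) ¬Q0
least-cong P? Q? P⇒Q Q⇒P (suc a) zero Pa Qb with P? zero
... | yes _   = refl
... | no ¬P0  = contradiction (Q⇒P Qb) ¬P0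
least-cong P? Q? P⇒Q Q⇒P (suc a) (suc b) Pa Qb with P? zero | Q? zero
... | yes _   | yes _   = refl
... | yes P0  | no ¬Q0  = contradiction (P⇒Q P0) ¬Q0
... | no ¬P0  | yes Q0  = contradiction (Q⇒P Q0) ¬P0
... | no _    | no _    = cong suc (least-cong (P? ∘ suc) (Q? ∘ suc) P⇒Q Q⇒P a b Pa Qb)

module Classes {n : ℕ} {_~_ : Fin n → Fin n → Set} (isDecEquivalence : IsDecEquivalence _~_) where

  open IsDecEquivalence isDecEquivalence public
    using () renaming (_≟_ to _~?_; refl to ~-refl; sym to ~-sym; trans to ~-trans)

  -- Opaque, so that unification never unfolds the search for the least element.
  opaque
    canon : Fin n → Fin n
    canon x = least (x ~?_) x ~-refl

    ~canon : ∀ x → x ~ canon x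
    ~canon x = least-holds (x ~?_) x ~-refl

    canon-cong : ∀ {x y} → x ~ y → canon x ≡ canon y
    canon-cong {x} {y} x~y = least-cong (x ~?_) (y ~?_) (~-trans (~-sym x~y)) (~-trans x~y) x y ~-refl ~-refl

  canon≡⇒~ : ∀ {x y} → canon x ≡ canon y → x ~ y
  canon≡⇒~ {x} {y} canon-x≡canon-y = ~-trans (~canon x) (subst (_~ y) (sym canon-x≡canon-y) (~-sym (~canon y)))

  IsCanon : Fin n → Set
  IsCanon r = canon r ≡ r

  isCanon? : Decidable IsCanon
  isCanon? r = canon r ≟ r

  canon-isCanon : ∀ x → IsCanon (canon x)
  canon-isCanon x = sym (canon-cong (~canon x))

  module _ {P : Fin n → Set} (P? : Decidable P) (P-resp-~ : ∀ {x y} → x ~ y → P x → P y) where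

    open Fibres P? canon

    count-canon-fibre : ∀ {y} → P y → IsCanon y → count (fibre? y) ≡ count (y ~?_)
    count-canon-fibre {y} Py canon-y≡y = count-cong (fibre? y) (y ~?_)
      (λ { (Px , refl) → ~-sym (~canon _) })
      (λ y~x → P-resp-~ y~x Py , trans (canon-cong (~-sym y~x)) canon-y≡y)

    count-canon-fibre-∅ : ∀ {y} → ¬ (P y × IsCanon y) → count (fibre? y) ≡ 0
    count-canon-fibre-∅ ¬Py×canon = count-∅ (fibre? _)
      λ { x (Px , refl) → ¬Py×canon (P-resp-~ (~canon x) Px , canon-isCanon x) }

    count-classes-const : ∀ c → (∀ y → count (y ~?_) ≡ c) → count P? ≡ count (P? ∩? isCanon?) * c
    count-classes-const c class-size = count-fibres-const (P? ∩? isCanon?) c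
      (λ { (Py , canon-y) → trans (count-canon-fibre Py canon-y) (class-size _) })
      count-canon-fibre-∅

count-all : ∀ {n} → count {n} (λ _ → yes tt) ≡ n
count-all {zero}  = refl
count-all {suc n} = cong suc (count-all {n})

module GroupTheory (G : FinGroup) where

  open FinGroup G

  group : Group 0ℓ 0ℓ
  group = record
    { isGroup = record
      { isMonoid = record
        { isSemigroup = record
          { isMagma = record { isEquivalence = isEquivalence ; ∙-cong = cong₂ _∙_ }
          ; assoc = assoc }
        ; identity = identityˡ , identityʳ }
      ; inverse = inverseˡ , inverseʳ
      ; ⁻¹-cong = cong _⁻¹ } }

  open GroupProperties group public
    using (⁻¹-involutive; ⁻¹-anti-homo-∙; ε⁻¹≈ε; ∙-cancelˡ; inverseʳ-unique;
           \\-leftDividesˡ; \\-leftDividesʳ; //-rightDividesʳ)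

  pow : El G → ℕ → El G
  pow x zero    = ε
  pow x (suc e) = x ∙ pow x e

  pow-+ : ∀ x d e → pow x (d + e) ≡ pow x d ∙ pow x e
  pow-+ x zero    e = sym (identityˡ _)
  pow-+ x (suc d) e = trans (cong (x ∙_) (pow-+ x d e)) (sym (assoc _ _ _))

  -- Two of the powers x⁰, …, x^order coincide, so x has finite order.
  ⁻¹≡pow : ∀ x → ∃[ e ] x ⁻¹ ≡ pow x e
  ⁻¹≡pow x with pigeonhole (ℕ.n<1+n order) (λ i → pow x (toℕ i))
  ... | i , j , i<j , xⁱ≡xʲ = d , sym (inverseʳ-unique x (pow x d) x∙xᵈ≡ε)
    where
    d = toℕ j ∸ suc (toℕ i)
    xⁱ∙x∙xᵈ≡xⁱ∙ε : pow x (toℕ i) ∙ (x ∙ pow x d) ≡ pow x (toℕ i) ∙ ε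
    xⁱ∙x∙xᵈ≡xⁱ∙ε = begin
      pow x (toℕ i) ∙ (x ∙ pow x d)   ≡⟨ pow-+ x (toℕ i) (suc d) ⟨
      pow x (toℕ i + suc d)           ≡⟨ cong (pow x) (trans (ℕ.+-suc (toℕ i) d) (ℕ.m+[n∸m]≡n i<j)) ⟩
      pow x (toℕ j)                   ≡⟨ xⁱ≡xʲ ⟨
      pow x (toℕ i)                   ≡⟨ identityʳ _ ⟨
      pow x (toℕ i) ∙ ε               ∎
      where open ≡-Reasoning
    x∙xᵈ≡ε : x ∙ pow x d ≡ ε
    x∙xᵈ≡ε = ∙-cancelˡ (pow x (toℕ i)) _ _ xⁱ∙x∙xᵈ≡xⁱ∙ε

  ∙-closed⇒⁻¹-closed : {P : El G → Set} → P ε → (∀ {x y} → P x → P y → P (x ∙ y)) →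
                       ∀ {x} → P x → P (x ⁻¹)
  ∙-closed⇒⁻¹-closed {P} Pε P∙ {x} Px with ⁻¹≡pow x
  ... | e , x⁻¹≡xᵉ = subst P (sym x⁻¹≡xᵉ) (P-pow e)
    where
    P-pow : ∀ e → P (pow x e)
    P-pow zero    = Pε
    P-pow (suc e) = P∙ Px (P-pow e)

  conj : El G → El G → El G
  conj g x = ((g ⁻¹) ∙ x) ∙ g

  conj-∙ : ∀ g x y → conj g (x ∙ y) ≡ conj g x ∙ conj g y
  conj-∙ g x y = begin
    ((g ⁻¹) ∙ (x ∙ y)) ∙ g                        ≡⟨ cong (_∙ g) (assoc (g ⁻¹) x y) ⟨
    (((g ⁻¹) ∙ x) ∙ y) ∙ g                        ≡⟨ assoc _ y g ⟩
    ((g ⁻¹) ∙ x) ∙ (y ∙ g)                        ≡⟨ cong (((g ⁻¹) ∙ x) ∙_) (\\-leftDividesˡ g (y ∙ g)) ⟨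
    ((g ⁻¹) ∙ x) ∙ (g ∙ ((g ⁻¹) ∙ (y ∙ g)))       ≡⟨ assoc _ g _ ⟨
    conj g x ∙ ((g ⁻¹) ∙ (y ∙ g))                 ≡⟨ cong (conj g x ∙_) (assoc (g ⁻¹) y g) ⟨
    conj g x ∙ conj g y                           ∎
    where open ≡-Reasoning

  conj-∙ˡ : ∀ g h x → conj (g ∙ h) x ≡ conj h (conj g x)
  conj-∙ˡ g h x = begin
    (((g ∙ h) ⁻¹) ∙ x) ∙ (g ∙ h)             ≡⟨ cong (λ u → (u ∙ x) ∙ (g ∙ h)) (⁻¹-anti-homo-∙ g h) ⟩
    (((h ⁻¹) ∙ (g ⁻¹)) ∙ x) ∙ (g ∙ h)        ≡⟨ cong (_∙ (g ∙ h)) (assoc _ _ x) ⟩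
    ((h ⁻¹) ∙ ((g ⁻¹) ∙ x)) ∙ (g ∙ h)        ≡⟨ assoc _ g h ⟨
    (((h ⁻¹) ∙ ((g ⁻¹) ∙ x)) ∙ g) ∙ h        ≡⟨ cong (_∙ h) (assoc _ _ g) ⟩
    ((h ⁻¹) ∙ conj g x) ∙ h                  ∎
    where open ≡-Reasoning

  conj-by-ε : ∀ x → conj ε x ≡ x
  conj-by-ε x = trans (identityʳ _) (trans (cong (_∙ x) ε⁻¹≈ε) (identityˡ x))

  conj-inverse : ∀ g x → conj (g ⁻¹) (conj g x) ≡ x
  conj-inverse g x = trans (sym (conj-∙ˡ g (g ⁻¹) x)) (trans (cong (λ u → conj u x) (inverseʳ g)) (conj-by-ε x))

  conj-ε : ∀ g → conj g ε ≡ ε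
  conj-ε g = trans (cong (_∙ g) (identityʳ _)) (inverseˡ g)

  conj-⁻¹ : ∀ g x → conj g (x ⁻¹) ≡ conj g x ⁻¹
  conj-⁻¹ g x = inverseʳ-unique (conj g x) (conj g (x ⁻¹))
    (trans (sym (conj-∙ g x (x ⁻¹))) (trans (cong (conj g) (inverseʳ x)) (conj-ε g)))

  ⁅_,_⁆ : El G → El G → El G
  ⁅ a , b ⁆ = [_,_] G a b

  ⁅,⁆≡⁻¹∙conj : ∀ a b → ⁅ a , b ⁆ ≡ (a ⁻¹) ∙ conj b a
  ⁅,⁆≡⁻¹∙conj a b = trans (assoc (a ⁻¹) (b ⁻¹) (a ∙ b)) (cong ((a ⁻¹) ∙_) (sym (assoc (b ⁻¹) a b)))

  conj-⁅,⁆ : ∀ g a b → conj g ⁅ a , b ⁆ ≡ ⁅ conj g a , conj g b ⁆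
  conj-⁅,⁆ g a b = trans (conj-∙ g _ _)
    (cong₂ _∙_ (trans (conj-∙ g _ _) (cong₂ _∙_ (conj-⁻¹ g a) (conj-⁻¹ g b))) (conj-∙ g a b))

  ⁅,⁆-⁻¹ : ∀ a b → ⁅ a , b ⁆ ⁻¹ ≡ ⁅ b , a ⁆
  ⁅,⁆-⁻¹ a b = trans (⁻¹-anti-homo-∙ _ _) (cong₂ _∙_ (⁻¹-anti-homo-∙ a b)
    (trans (⁻¹-anti-homo-∙ (a ⁻¹) (b ⁻¹)) (cong₂ _∙_ (⁻¹-involutive b) (⁻¹-involutive a))))

  ⁅,⁆-self : ∀ x → ⁅ x , x ⁆ ≡ ε
  ⁅,⁆-self x = trans (assoc _ _ _) (trans (cong ((x ⁻¹) ∙_) (\\-leftDividesʳ x x)) (inverseˡ x))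

  ⁅,⁆-∙ʳ : ∀ x y w → ⁅ x , y ∙ w ⁆ ≡ ⁅ x , w ⁆ ∙ conj w ⁅ x , y ⁆
  ⁅,⁆-∙ʳ x y w = begin
    ⁅ x , y ∙ w ⁆                           ≡⟨ ⁅,⁆≡⁻¹∙conj x (y ∙ w) ⟩
    (x ⁻¹) ∙ conj (y ∙ w) x                 ≡⟨ cong ((x ⁻¹) ∙_) (conj-∙ˡ y w x) ⟩
    (x ⁻¹) ∙ conj w xʸ                      ≡⟨ cong ((x ⁻¹) ∙_) (\\-leftDividesˡ xʷ _) ⟨
    (x ⁻¹) ∙ (xʷ ∙ ((xʷ ⁻¹) ∙ conj w xʸ))   ≡⟨ assoc _ _ _ ⟨
    ((x ⁻¹) ∙ xʷ) ∙ ((xʷ ⁻¹) ∙ conj w xʸ)   ≡⟨ cong₂ _∙_ (sym (⁅,⁆≡⁻¹∙conj x w)) conj-w-split ⟩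
    ⁅ x , w ⁆ ∙ conj w ((x ⁻¹) ∙ xʸ)        ≡⟨ cong (λ c → ⁅ x , w ⁆ ∙ conj w c) (⁅,⁆≡⁻¹∙conj x y) ⟨
    ⁅ x , w ⁆ ∙ conj w ⁅ x , y ⁆            ∎
    where
    open ≡-Reasoning
    xʸ = conj y x
    xʷ = conj w x
    conj-w-split : (xʷ ⁻¹) ∙ conj w xʸ ≡ conj w ((x ⁻¹) ∙ xʸ)
    conj-w-split = trans (cong (_∙ conj w xʸ) (sym (conj-⁻¹ w x))) (sym (conj-∙ w (x ⁻¹) xʸ))

  record IsDecSubgroup (M : El G → Set) : Set where
    field
      dec       : Decidable M
      ε-closed  : M ε
      ∙-closed  : ∀ {x y} → M x → M y → M (x ∙ y)
      ⁻¹-closed : ∀ {x} → M x → M (x ⁻¹)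

  isDecSubgroup : {M : El G → Set} → Decidable M → M ε → (∀ {x y} → M x → M y → M (x ∙ y)) → IsDecSubgroup M
  isDecSubgroup {M} M? Mε M∙ = record
    { dec = M? ; ε-closed = Mε ; ∙-closed = M∙ ; ⁻¹-closed = ∙-closed⇒⁻¹-closed {M} Mε M∙ }

  ⊤-subgroup : IsDecSubgroup (λ _ → ⊤)
  ⊤-subgroup = isDecSubgroup (λ _ → yes tt) tt (λ _ _ → tt)

  IsNormal : (El G → Set) → Set
  IsNormal M = ∀ g {x} → M x → M (conj g x)

  module Cosets {M : El G → Set} (M-subgroup : IsDecSubgroup M) where

    open IsDecSubgroup M-subgroup renaming (dec to M?)

    _~_ : El G → El G → Set
    x ~ y = M ((x ⁻¹) ∙ y)

    ~-isDecEquivalence : IsDecEquivalence _~_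
    ~-isDecEquivalence = record
      { isEquivalence = record
        { refl  = λ {x} → subst M (sym (inverseˡ x)) ε-closed
        ; sym   = λ {x} {y} x~y →
            subst M (trans (⁻¹-anti-homo-∙ (x ⁻¹) y) (cong ((y ⁻¹) ∙_) (⁻¹-involutive x))) (⁻¹-closed x~y)
        ; trans = λ {x} {y} {z} x~y y~z →
            subst M (trans (assoc _ _ _) (cong ((x ⁻¹) ∙_) (\\-leftDividesˡ y z))) (∙-closed x~y y~z) }
      ; _≟_ = λ x y → M? ((x ⁻¹) ∙ y) }

    open Classes ~-isDecEquivalence public

    ~-∙ˡ : ∀ g {x y} → x ~ y → (g ∙ x) ~ (g ∙ y)
    ~-∙ˡ g {x} {y} = subst M (sym (begin
      ((g ∙ x) ⁻¹) ∙ (g ∙ y)             ≡⟨ cong (_∙ (g ∙ y)) (⁻¹-anti-homo-∙ g x) ⟩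
      ((x ⁻¹) ∙ (g ⁻¹)) ∙ (g ∙ y)        ≡⟨ assoc _ _ _ ⟩
      (x ⁻¹) ∙ ((g ⁻¹) ∙ (g ∙ y))        ≡⟨ cong ((x ⁻¹) ∙_) (\\-leftDividesʳ g y) ⟩
      (x ⁻¹) ∙ y                         ∎))
      where open ≡-Reasoning

    M⇒ε~ : ∀ {x} → M x → ε ~ x
    M⇒ε~ = subst M (sym (trans (cong (_∙ _) ε⁻¹≈ε) (identityˡ _)))

    ε~⇒M : ∀ {x} → ε ~ x → M x
    ε~⇒M = subst M (trans (cong (_∙ _) ε⁻¹≈ε) (identityˡ _))

    χ : El G → Bool
    χ x = not (does (M? x))

    χ-∈ : ∀ {x} → M x → χ x ≡ false
    χ-∈ {x} Mx = cong not (dec-true (M? x) Mx)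

    χ-∉ : ∀ {x} → ¬ M x → χ x ≡ true
    χ-∉ {x} ¬Mx = cong not (dec-false (M? x) ¬Mx)

    χ≡false⇒∈ : ∀ {x} → χ x ≡ false → M x
    χ≡false⇒∈ {x} χx≡false =
      decidable-stable (M? x) (λ ¬Mx → contradiction (trans (sym (χ-∉ ¬Mx)) χx≡false) λ ())

    χ-cong : ∀ {x y} → (M x → M y) → (M y → M x) → χ x ≡ χ y
    χ-cong {x} {y} Mx⇒My My⇒Mx with M? x
    ... | yes Mx = sym (χ-∈ (Mx⇒My Mx))
    ... | no ¬Mx = sym (χ-∉ (¬Mx ∘ My⇒Mx))

    χ-∙ : {D : El G → Set} → (∀ {a b} → D a → D b → ¬ M a → ¬ M b → M (a ∙ b)) →
          ∀ {a b} → D a → D b → χ (a ∙ b) ≡ χ a xor χ b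
    χ-∙ ∉∙∉⇒∈ {a} {b} Da Db with M? a | M? b | M? (a ∙ b)
    ... | yes Ma | yes Mb | yes _    = refl
    ... | yes Ma | yes Mb | no ¬Mab  = contradiction (∙-closed Ma Mb) ¬Mab
    ... | yes Ma | no ¬Mb | yes Mab  = contradiction (subst M (\\-leftDividesʳ a b) (∙-closed (⁻¹-closed Ma) Mab)) ¬Mb
    ... | yes Ma | no ¬Mb | no _     = refl
    ... | no ¬Ma | yes Mb | yes Mab  = contradiction (subst M (//-rightDividesʳ b a) (∙-closed Mab (⁻¹-closed Mb))) ¬Ma
    ... | no ¬Ma | yes Mb | no _     = refl
    ... | no ¬Ma | no ¬Mb | yes _    = refl
    ... | no ¬Ma | no ¬Mb | no ¬Mab  = contradiction (∉∙∉⇒∈ Da Db ¬Ma ¬Mb) ¬Mab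

    class-size : ∀ y → count (y ~?_) ≡ count M?
    class-size y = count-bij (y ~?_) M? ((y ⁻¹) ∙_) (y ∙_) (λ y~x → y~x)
      (subst M (sym (\\-leftDividesʳ y _))) (λ _ → \\-leftDividesˡ y _) (λ _ → \\-leftDividesʳ y _)

    lagrange : {K : El G → Set} (K? : Decidable K) → (∀ {x y} → x ~ y → K x → K y) →
               count K? ≡ count (K? ∩? isCanon?) * count M?
    lagrange K? K-resp-~ = count-classes-const K? K-resp-~ (count M?) class-size

    |M|∣order : count M? ∣ order
    |M|∣order = divides (count ((λ _ → yes tt) ∩? isCanon?))
      (trans (sym count-all) (lagrange (λ _ → yes tt) (λ _ _ → tt)))

  module Action {K : El G → Set} (K-subgroup : IsDecSubgroup K)
                {j : ℕ} (|K|∣2^j : count (IsDecSubgroup.dec K-subgroup) ∣ 2 ^ j)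
                {n : ℕ} {T : Fin n → Set} (T? : Decidable T) (act : El G → Fin n → Fin n)
                (act-ε : ∀ {x} → T x → act ε x ≡ x)
                (act-∙ : ∀ g h {x} → K g → K h → T x → act (g ∙ h) x ≡ act g (act h x))
                (act-T : ∀ g {x} → K g → T x → T (act g x)) where

    open IsDecSubgroup K-subgroup renaming (dec to K?)

    Fixed : Fin n → Set
    Fixed x = ∀ g → K g → act g x ≡ x

    fixed? : Decidable Fixed
    fixed? x = all? (λ g → K? g →-dec (act g x ≟ x))

    -- Extended by the identity outside T, so that the orbits partition all of Fin n.
    act′ : El G → Fin n → Fin n
    act′ g x with T? x
    ... | yes _ = act g x
    ... | no  _ = x

    act′≡act : ∀ {g x} → T x → act′ g x ≡ act g x
    act′≡act {g} {x} Tx with T? x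
    ... | yes _  = refl
    ... | no ¬Tx = contradiction Tx ¬Tx

    act′-ε : ∀ x → act′ ε x ≡ x
    act′-ε x with T? x
    ... | yes Tx = act-ε Tx
    ... | no  _  = refl

    act′-∙ : ∀ {g h} → K g → K h → ∀ x → act′ (g ∙ h) x ≡ act′ g (act′ h x)
    act′-∙ {g} {h} Kg Kh x with T? x
    ... | yes Tx = trans (act-∙ g h Kg Kh Tx) (sym (act′≡act (act-T h Kh Tx)))
    ... | no ¬Tx with T? x
    ...   | yes Tx = contradiction Tx ¬Tx
    ...   | no  _  = refl

    act′-inverse : ∀ {g} → K g → ∀ x → act′ (g ⁻¹) (act′ g x) ≡ x
    act′-inverse {g} Kg x =
      trans (sym (act′-∙ (⁻¹-closed Kg) Kg x)) (trans (cong (λ u → act′ u x) (inverseˡ g)) (act′-ε x))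

    _≈_ : Fin n → Fin n → Set
    x ≈ y = ∃[ g ] K g × act′ g x ≡ y

    orbit-isDecEquivalence : IsDecEquivalence _≈_
    orbit-isDecEquivalence = record
      { isEquivalence = record
        { refl  = λ {x} → ε , ε-closed , act′-ε x
        ; sym   = λ { {x} (g , Kg , refl) → g ⁻¹ , ⁻¹-closed Kg , act′-inverse Kg x }
        ; trans = λ { {x} (g , Kg , refl) (h , Kh , refl) → h ∙ g , ∙-closed Kh Kg , act′-∙ Kh Kg x } }
      ; _≟_ = λ x y → any? (λ g → K? g ×-dec (act′ g x ≟ y)) }

    open Classes orbit-isDecEquivalence renaming (_~?_ to _≈?_; ~-refl to ≈-refl)

    stab? : ∀ x → Decidable (λ g → K g × act′ g x ≡ x)
    stab? x g = K? g ×-dec (act′ g x ≟ x)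

    orbit-stabiliser : ∀ x → count K? ≡ count (x ≈?_) * count (stab? x)
    orbit-stabiliser x = count-fibres-const (x ≈?_) _ fibre-over-orbit fibre-off-orbit
      where
      open Fibres K? (λ g → act′ g x)
      fibre-over-orbit : ∀ {y} → x ≈ y → count (fibre? y) ≡ count (stab? x)
      fibre-over-orbit (g₀ , Kg₀ , refl) = count-bij (fibre? _) (stab? x)
        ((g₀ ⁻¹) ∙_) (g₀ ∙_)
        (λ { {g} (Kg , g·x≡g₀·x) → ∙-closed (⁻¹-closed Kg₀) Kg ,
               trans (act′-∙ (⁻¹-closed Kg₀) Kg x) (trans (cong (act′ (g₀ ⁻¹)) g·x≡g₀·x) (act′-inverse Kg₀ x)) })
        (λ { {s} (Ks , s·x≡x) → ∙-closed Kg₀ Ks , trans (act′-∙ Kg₀ Ks x) (cong (act′ g₀) s·x≡x) })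
        (λ _ → \\-leftDividesˡ g₀ _) (λ _ → \\-leftDividesʳ g₀ _)
      fibre-off-orbit : ∀ {y} → ¬ x ≈ y → count (fibre? y) ≡ 0
      fibre-off-orbit x≉y = count-∅ (fibre? _) λ g (Kg , g·x≡y) → x≉y (g , Kg , g·x≡y)

    orbit-size-1⇒fixed : ∀ {x} → T x → count (x ≈?_) ≡ 1 → Fixed x
    orbit-size-1⇒fixed {x} Tx size≡1 g Kg = trans (sym (act′≡act Tx))
      (count≡1⇒unique (x ≈?_) size≡1 (g , Kg , refl) (≈-refl {x}))

    fixed⇒orbit-singleton : ∀ {x y} → T x → Fixed x → x ≈ y → y ≡ x
    fixed⇒orbit-singleton Tx Fx (g , Kg , refl) = trans (act′≡act Tx) (Fx g Kg)

    T-resp-≈ : ∀ {x y} → x ≈ y → T x → T y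
    T-resp-≈ (g , Kg , refl) Tx = subst T (sym (act′≡act Tx)) (act-T g Kg Tx)

    orbit∣K : ∀ x → count (x ≈?_) ∣ count K?
    orbit∣K x = divides (count (stab? x)) (trans (orbit-stabiliser x) (ℕ.*-comm (count (x ≈?_)) (count (stab? x))))

    fixed-points-even : 2 ∣ count T? → 2 ∣ count (T? ∩? fixed?)
    fixed-points-even = count-fibres-parity (T? ∩? fixed?) over-fixed off-fixed
      where
      open Fibres T? canon
      over-fixed : ∀ {y} → T y × Fixed y → count (fibre? y) ≡ 1
      over-fixed {y} (Ty , Fy) = trans
        (count-canon-fibre T? T-resp-≈ Ty (fixed⇒orbit-singleton Ty Fy (~canon y)))
        (count-singleton (y ≈?_) ≈-refl (fixed⇒orbit-singleton Ty Fy))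
      off-fixed : ∀ {y} → ¬ (T y × Fixed y) → 2 ∣ count (fibre? y)
      off-fixed {y} ¬Fy with T? y ×-dec isCanon? y
      ... | no ¬Ty×canon = subst (2 ∣_) (sym (count-canon-fibre-∅ T? T-resp-≈ ¬Ty×canon)) (divides 0 refl)
      ... | yes (Ty , canon-y) with ∣2^⇒≡1⊎2∣ j (∣-trans (orbit∣K y) |K|∣2^j)
      ...   | inj₁ size≡1 = contradiction (Ty , orbit-size-1⇒fixed Ty size≡1) ¬Fy
      ...   | inj₂ 2∣size = subst (2 ∣_) (sym (count-canon-fibre T? T-resp-≈ Ty canon-y)) 2∣size

    opaque
      another-fixed-point : 2 ∣ count T? → ∀ {a} → T a → Fixed a → ∃[ b ] (T b × Fixed b) × b ≢ a
      another-fixed-point 2∣T Ta Fa = 2∣count⇒∃≢ (T? ∩? fixed?) (fixed-points-even 2∣T) (Ta , Fa)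

  ⟨⟩-minimal : {S P : El G → Set} →
               P ε → (∀ {x y} → P x → P y → P (x ∙ y)) → (∀ {x} → P x → P (x ⁻¹)) →
               (∀ {x} → S x → P x) → ∀ {x} → ⟨_⟩ G S x → P x
  ⟨⟩-minimal Pε P∙ P⁻¹ S⊆P (gen Sx)  = S⊆P Sx
  ⟨⟩-minimal Pε P∙ P⁻¹ S⊆P one       = Pε
  ⟨⟩-minimal Pε P∙ P⁻¹ S⊆P (mul p q) = P∙ (⟨⟩-minimal Pε P∙ P⁻¹ S⊆P p) (⟨⟩-minimal Pε P∙ P⁻¹ S⊆P q)
  ⟨⟩-minimal Pε P∙ P⁻¹ S⊆P (inv p)   = P⁻¹ (⟨⟩-minimal Pε P∙ P⁻¹ S⊆P p)

  module Generated {S : El G → Set} (S? : Decidable S) where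

    Reach : ℕ → El G → Set
    Reach zero    x = x ≡ ε
    Reach (suc i) x = Reach i x ⊎ (∃[ d ] ∃[ s ] Reach i d × S s × x ≡ d ∙ s)

    reach? : ∀ i → Decidable (Reach i)
    reach? zero    x = x ≟ ε
    reach? (suc i) x = reach? i x ⊎-dec any? (λ d → any? (λ s → reach? i d ×-dec S? s ×-dec (x ≟ d ∙ s)))

    Reach-ε : ∀ i → Reach i ε
    Reach-ε zero    = refl
    Reach-ε (suc i) = inj₁ (Reach-ε i)

    Reach⊆⟨⟩ : ∀ i {x} → Reach i x → ⟨_⟩ G S x
    Reach⊆⟨⟩ zero    refl                            = one
    Reach⊆⟨⟩ (suc i) (inj₁ r)                        = Reach⊆⟨⟩ i r
    Reach⊆⟨⟩ (suc i) (inj₂ (d , s , r , Ss , refl)) = mul (Reach⊆⟨⟩ i r) (gen Ss)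

    Stable : ℕ → Set
    Stable i = ∀ {x} → Reach (suc i) x → Reach i x

    opaque
      stable : ∃[ i ] Stable i
      stable = bounded-ascent (λ i → count (reach? i)) order (λ i → count-≤ (reach? i)) grow-or-stable 0
        where
        grow-or-stable : ∀ i → Stable i ⊎ ∃[ i′ ] count (reach? i) < count (reach? i′)
        grow-or-stable i with any? (λ x → reach? (suc i) x ×-dec ¬? (reach? i x))
        ... | yes (x , new , ¬old) = inj₂ (suc i , count-mono-< (reach? i) (reach? (suc i)) inj₁ ¬old new)
        ... | no ∄new = inj₁ λ {x} r → decidable-stable (reach? i x) (λ ¬old → ∄new (x , r , ¬old))

    module _ (i : ℕ) (stable-i : Stable i) where

      Reach-∙ : ∀ l {x y} → Reach i x → Reach l y → Reach i (x ∙ y)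
      Reach-∙ zero    {x} r refl = subst (Reach i) (sym (identityʳ x)) r
      Reach-∙ (suc l) r (inj₁ r′) = Reach-∙ l r r′
      Reach-∙ (suc l) {x} r (inj₂ (d , s , r′ , Ss , refl)) =
        subst (Reach i) (assoc x d s) (stable-i (inj₂ (x ∙ d , s , Reach-∙ l r r′ , Ss , refl)))

      ⟨⟩⊆Reach : ∀ {x} → ⟨_⟩ G S x → Reach i x
      ⟨⟩⊆Reach = ⟨⟩-minimal (Reach-ε i) (Reach-∙ i) (∙-closed⇒⁻¹-closed {Reach i} (Reach-ε i) (Reach-∙ i))
        λ {x} Sx → subst (Reach i) (identityˡ x) (stable-i (inj₂ (ε , x , Reach-ε i , Sx , refl)))

    ⟨⟩? : Decidable (⟨_⟩ G S)
    ⟨⟩? x = map′ (Reach⊆⟨⟩ i) (⟨⟩⊆Reach i stable-i) (reach? i x)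
      where
      i = proj₁ stable
      stable-i = proj₂ stable

  G′? : Decidable (G′ G)
  G′? = Generated.⟨⟩? λ z → any? λ a → any? λ b → yes tt ×-dec yes tt ×-dec (z ≟ ⁅ a , b ⁆)

  G′-subgroup : IsDecSubgroup (G′ G)
  G′-subgroup = record { dec = G′? ; ε-closed = one ; ∙-closed = mul ; ⁻¹-closed = inv }

  G′-normal : IsNormal (G′ G)
  G′-normal g (gen (a , b , _ , _ , refl)) = gen (conj g a , conj g b , tt , tt , conj-⁅,⁆ g a b)
  G′-normal g one       = subst (G′ G) (sym (conj-ε g)) one
  G′-normal g (mul p q) = subst (G′ G) (sym (conj-∙ g _ _)) (mul (G′-normal g p) (G′-normal g q))
  G′-normal g (inv p)   = subst (G′ G) (sym (conj-⁻¹ g _)) (inv (G′-normal g p))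

  derived⊆G′ : ∀ A {x} → derived G A x → G′ G x
  derived⊆G′ A = ⟨⟩-minimal one mul inv λ { (a , b , _ , _ , c≡⁅a,b⁆) → gen (a , b , tt , tt , c≡⁅a,b⁆) }

  G′trivial⇒derived≐G′ : G′trivial G → ∀ H → IsSubgroup G H → _≐_ G (derived G (mem G H)) (G′ G)
  G′trivial⇒derived≐G′ G′-trivial H _ =
    (λ _ → derived⊆G′ (mem G H)) , λ x G′x → subst (derived G (mem G H)) (sym (G′-trivial x G′x)) one

_+₂_ : Fin 2 → Fin 2 → Fin 2
zero     +₂ y        = y
suc zero +₂ zero     = suc zero
suc zero +₂ suc zero = zero

C₂ : FinGroup
C₂ = record
  { order = 2 ; _∙_ = _+₂_ ; ε = zero ; _⁻¹ = λ x → x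
  ; assoc = assoc ; identityˡ = λ _ → refl ; identityʳ = identityʳ
  ; inverseˡ = self-inverse ; inverseʳ = self-inverse }
  where
  assoc : ∀ x y z → (x +₂ y) +₂ z ≡ x +₂ (y +₂ z)
  assoc zero       y          z          = refl
  assoc (suc zero) zero       z          = refl
  assoc (suc zero) (suc zero) zero       = refl
  assoc (suc zero) (suc zero) (suc zero) = refl
  identityʳ : ∀ x → x +₂ zero ≡ x
  identityʳ zero       = refl
  identityʳ (suc zero) = refl
  self-inverse : ∀ x → x +₂ x ≡ zero
  self-inverse zero       = refl
  self-inverse (suc zero) = refl

module _ {n : ℕ} {S : Fin n → Set} (S? : Decidable S) (ι : Fin n → Fin n)
         (ι-S : ∀ {x} → S x → S (ι x)) (ι-involutive : ∀ {x} → S x → ι (ι x) ≡ x) where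

  private
    act : Fin 2 → Fin n → Fin n
    act zero       x = x
    act (suc zero) x = ι x

    act-∙ : ∀ g h {x} → ⊤ → ⊤ → S x → act (g +₂ h) x ≡ act g (act h x)
    act-∙ zero       h          _ _ Sx = refl
    act-∙ (suc zero) zero       _ _ Sx = refl
    act-∙ (suc zero) (suc zero) _ _ Sx = sym (ι-involutive Sx)

    act-S : ∀ g {x} → ⊤ → S x → S (act g x)
    act-S zero       _ Sx = Sx
    act-S (suc zero) _ Sx = ι-S Sx

    open GroupTheory C₂ using (⊤-subgroup; module Action)
    open Action ⊤-subgroup {j = 1} (divides 1 refl) S? act (λ _ → refl) act-∙ act-S

  opaque
    involution-another-fixed-point : 2 ∣ count S? → ∀ {a} → S a → ι a ≡ a → ∃[ b ] (S b × ι b ≡ b) × b ≢ a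
    involution-another-fixed-point 2∣S {a} Sa ιa≡a with another-fixed-point 2∣S Sa fixed-a
      where
      fixed-a : Fixed a
      fixed-a zero       _ = refl
      fixed-a (suc zero) _ = ιa≡a
    ... | b , (Sb , fixed-b) , b≢a = b , (Sb , fixed-b (suc zero) tt) , b≢a

module NormalSubgroup (G : FinGroup) {M : El G → Set} (M-subgroup : GroupTheory.IsDecSubgroup G M)
                      (M-normal : GroupTheory.IsNormal G M) where

  open FinGroup G
  open GroupTheory G
  open IsDecSubgroup M-subgroup renaming (dec to M?)
  open Cosets M-subgroup

  ~-conj : ∀ g {x y} → x ~ y → conj g x ~ conj g y
  ~-conj g {x} {y} x~y = subst M (trans (conj-∙ g (x ⁻¹) y) (cong (_∙ conj g y) (conj-⁻¹ g x))) (M-normal g x~y)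

  ~-⁻¹ : ∀ {x y} → x ~ y → (x ⁻¹) ~ (y ⁻¹)
  ~-⁻¹ {x} {y} x~y = subst M (trans (cong (_∙ (x ⁻¹)) (sym (assoc _ _ _))) (//-rightDividesʳ x _))
    (M-normal (x ⁻¹) (~-sym x~y))

  M∙~ : ∀ {z a b} → M a → z ~ b → z ~ (a ∙ b)
  M∙~ {z} {a} {b} Ma z~b = subst M aᶻ∙z⁻¹b≡z⁻¹ab (∙-closed (M-normal z Ma) z~b)
    where
    aᶻ∙z⁻¹b≡z⁻¹ab : conj z a ∙ ((z ⁻¹) ∙ b) ≡ (z ⁻¹) ∙ (a ∙ b)
    aᶻ∙z⁻¹b≡z⁻¹ab = trans (assoc _ z _) (trans (cong (((z ⁻¹) ∙ a) ∙_) (\\-leftDividesˡ z b)) (assoc _ a b))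

  ~∙~ : ∀ {z a b} → M (z ∙ z) → z ~ a → z ~ b → M (a ∙ b)
  ~∙~ {z} {a} {b} Mzz z~a z~b = subst M z²∙z⁻¹[z⁻¹a∙b]≡ab (∙-closed Mzz (M∙~ z~a z~b))
    where
    z²∙z⁻¹[z⁻¹a∙b]≡ab : (z ∙ z) ∙ ((z ⁻¹) ∙ (((z ⁻¹) ∙ a) ∙ b)) ≡ a ∙ b
    z²∙z⁻¹[z⁻¹a∙b]≡ab = begin
      (z ∙ z) ∙ ((z ⁻¹) ∙ (((z ⁻¹) ∙ a) ∙ b))   ≡⟨ assoc z z _ ⟩
      z ∙ (z ∙ ((z ⁻¹) ∙ (((z ⁻¹) ∙ a) ∙ b)))   ≡⟨ cong (z ∙_) (\\-leftDividesˡ z _) ⟩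
      z ∙ (((z ⁻¹) ∙ a) ∙ b)                    ≡⟨ assoc z _ b ⟨
      (z ∙ ((z ⁻¹) ∙ a)) ∙ b                    ≡⟨ cong (_∙ b) (\\-leftDividesˡ z a) ⟩
      a ∙ b                                     ∎
      where open ≡-Reasoning

  M∪zM : El G → El G → Set
  M∪zM z x = M x ⊎ z ~ x

  M∪zM-subgroup : ∀ {z} → M (z ∙ z) → IsDecSubgroup (M∪zM z)
  M∪zM-subgroup {z} Mzz = isDecSubgroup (λ x → M? x ⊎-dec (z ~? x)) (inj₁ ε-closed) closed
    where
    closed : ∀ {a b} → M∪zM z a → M∪zM z b → M∪zM z (a ∙ b)
    closed (inj₁ Ma)  (inj₁ Mb)  = inj₁ (∙-closed Ma Mb)
    closed (inj₁ Ma)  (inj₂ z~b) = inj₂ (M∙~ Ma z~b)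
    closed (inj₂ z~a) (inj₁ Mb)  = inj₂ (subst M (assoc _ _ _) (∙-closed z~a Mb))
    closed (inj₂ z~a) (inj₂ z~b) = inj₁ (~∙~ Mzz z~a z~b)

  M∪zM-normal : ∀ {z} → (∀ g → z ~ conj g z) → IsNormal (M∪zM z)
  M∪zM-normal z-central g (inj₁ Mx)  = inj₁ (M-normal g Mx)
  M∪zM-normal z-central g (inj₂ z~x) = inj₂ (~-trans (z-central g) (~-conj g z~x))

  -- Inversion permutes the cosets (this is where normality is used); a coset
  -- fixed by it squares into M, and the coset M itself is one such.
  opaque
    ∃-square∈M : {T : El G → Set} (T? : Decidable T) → (∀ {x y} → x ~ y → T x → T y) →
                 (∀ {x} → T x → T (x ⁻¹)) → T ε → 2 ∣ count (T? ∩? isCanon?) →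
                 ∃[ z ] T z × ¬ M z × M (z ∙ z)
    ∃-square∈M {T} T? T-resp-~ T-⁻¹ Tε 2∣cosets
      with involution-another-fixed-point (T? ∩? isCanon?) ι ι-preserves ι-involutive 2∣cosets canon-ε∈ ι-canon-ε
      where
      ι : El G → El G
      ι r = canon (r ⁻¹)
      ι-preserves : ∀ {r} → T r × IsCanon r → T (ι r) × IsCanon (ι r)
      ι-preserves {r} (Tr , _) = T-resp-~ (~canon (r ⁻¹)) (T-⁻¹ Tr) , canon-isCanon (r ⁻¹)
      ι-involutive : ∀ {r} → T r × IsCanon r → ι (ι r) ≡ r
      ι-involutive {r} (_ , canon-r) =
        trans (sym (canon-cong (subst (_~ (ι r ⁻¹)) (⁻¹-involutive r) (~-⁻¹ (~canon (r ⁻¹)))))) canon-r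
      canon-ε∈ : T (canon ε) × IsCanon (canon ε)
      canon-ε∈ = T-resp-~ (~canon ε) Tε , canon-isCanon ε
      ι-canon-ε : ι (canon ε) ≡ canon ε
      ι-canon-ε = canon-cong (subst (canon ε ⁻¹ ~_) ε⁻¹≈ε (~-⁻¹ (~-sym (~canon ε))))
    ... | r , ((Tr , canon-r) , ιr≡r) , r≢canon-ε = r , Tr , ¬Mr , Mrr
      where
      ¬Mr : ¬ M r
      ¬Mr Mr = r≢canon-ε (trans (sym canon-r) (sym (canon-cong (M⇒ε~ Mr))))
      Mrr : M (r ∙ r)
      Mrr = subst (λ u → M (u ∙ r)) (⁻¹-involutive r) (subst (r ⁻¹ ~_) ιr≡r (~canon (r ⁻¹)))

∈-tabulate⁻ : ∀ {n} {P : Fin n → Set} (P? : Decidable P) {x} → x ∈ tabulate (does ∘ P?) → P x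
∈-tabulate⁻ P? {x} x∈ with P? x | trans (sym (lookup∘tabulate (does ∘ P?) x)) ([]=⇒lookup x∈)
... | yes Px | _ = Px
... | no  _  | ()

∈-tabulate⁺ : ∀ {n} {P : Fin n → Set} (P? : Decidable P) {x} → P x → x ∈ tabulate (does ∘ P?)
∈-tabulate⁺ P? {x} Px = lookup⇒[]= x _ (trans (lookup∘tabulate (does ∘ P?) x) (dec-true (P? x) Px))

module TwoGroup (G : FinGroup) {k : ℕ} (order≡2^k : FinGroup.order G ≡ 2 ^ k) where

  open FinGroup G
  open GroupTheory G

  |M|∣2^k : ∀ {M} (M-subgroup : IsDecSubgroup M) → count (IsDecSubgroup.dec M-subgroup) ∣ 2 ^ k
  |M|∣2^k M-subgroup = subst (_ ∣_) order≡2^k (Cosets.|M|∣order M-subgroup)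

  module _ {M K : El G → Set} (M-subgroup : IsDecSubgroup M) (K-subgroup : IsDecSubgroup K)
           (M⊆K : ∀ {x} → M x → K x) where

    open Cosets M-subgroup
    open IsDecSubgroup M-subgroup using () renaming (dec to M?)
    private module K = IsDecSubgroup K-subgroup

    K-resp-~ : ∀ {x y} → x ~ y → K x → K y
    K-resp-~ {x} {y} x~y Kx = subst K (\\-leftDividesˡ x y) (K.∙-closed Kx (M⊆K x~y))

    cosets-even : ∀ {y} → K y → ¬ M y → 2 ∣ count (K.dec ∩? isCanon?)
    cosets-even {y} Ky ¬My with ∣2^⇒≡1⊎2∣ k (∣-trans #cosets∣|K| (|M|∣2^k K-subgroup))
      where
      #cosets∣|K| : count (K.dec ∩? isCanon?) ∣ count K.dec
      #cosets∣|K| = divides (count M?) (trans (lagrange K.dec K-resp-~) (ℕ.*-comm _ (count M?)))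
    ... | inj₂ 2∣cosets = 2∣cosets
    ... | inj₁ one-coset = contradiction (ε~⇒M (canon≡⇒~ canon-ε≡canon-y)) ¬My
      where
      K-canon : ∀ {x} → K x → K (canon x) × IsCanon (canon x)
      K-canon {x} Kx = K-resp-~ (~canon x) Kx , canon-isCanon x
      canon-ε≡canon-y : canon ε ≡ canon y
      canon-ε≡canon-y = count≡1⇒unique (K.dec ∩? isCanon?) one-coset (K-canon K.ε-closed) (K-canon Ky)

  module Maximal (H : Subset order) (H-maximal : IsMaximalSubgroup G H) where

    H-subgroup : IsDecSubgroup (_∈ H)
    H-subgroup = record
      { dec = _∈? H
      ; ε-closed = proj₁ (proj₁ H-maximal)
      ; ∙-closed = λ {x} {y} → proj₁ (proj₂ (proj₁ H-maximal)) x y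
      ; ⁻¹-closed = λ {x} → proj₂ (proj₂ (proj₁ H-maximal)) x }

    maximality : ∀ {P} → IsDecSubgroup P → (∀ {x} → x ∈ H → P x) → ∀ {y} → P y → y ∉ H → ∀ x → P x
    maximality {P} P-subgroup H⊆P {y} Py y∉H x =
      [ (λ K⊆H → contradiction (K⊆H y (∈-tabulate⁺ P? Py)) y∉H) , (λ K-all → ∈-tabulate⁻ P? (K-all x)) ]′
        (proj₂ (proj₂ H-maximal) K K-subgroup (λ _ → ∈-tabulate⁺ P? ∘ H⊆P))
      where
      module P = IsDecSubgroup P-subgroup
      P? = P.dec
      K : Subset order
      K = tabulate (does ∘ P?)
      K-subgroup : IsSubgroup G K
      K-subgroup = ∈-tabulate⁺ P? P.ε-closed
                 , (λ a b a∈K b∈K → ∈-tabulate⁺ P? (P.∙-closed (∈-tabulate⁻ P? a∈K) (∈-tabulate⁻ P? b∈K)))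
                 , (λ a a∈K → ∈-tabulate⁺ P? (P.⁻¹-closed (∈-tabulate⁻ P? a∈K)))

    open IsDecSubgroup H-subgroup using (∙-closed; ⁻¹-closed)
    open Cosets H-subgroup

    outside : ∃[ y ] y ∉ H
    outside = proj₁ (proj₂ H-maximal)

    module LeftMultiplicationOnCosets where

      act-ε : ∀ {r} → ⊤ × IsCanon r → canon (ε ∙ r) ≡ r
      act-ε {r} (_ , canon-r) = trans (cong canon (identityˡ r)) canon-r

      act-∙ : ∀ g h {x} → g ∈ H → h ∈ H → ⊤ × IsCanon x → canon ((g ∙ h) ∙ x) ≡ canon (g ∙ canon (h ∙ x))
      act-∙ g h {x} _ _ _ =
        canon-cong (subst (_~ (g ∙ canon (h ∙ x))) (sym (assoc g h x)) (~-∙ˡ g (~canon (h ∙ x))))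

      act-T : ∀ g {x} → g ∈ H → ⊤ × IsCanon x → ⊤ × IsCanon (canon (g ∙ x))
      act-T g {x} _ _ = tt , canon-isCanon (g ∙ x)

      open Action H-subgroup {k} (|M|∣2^k H-subgroup) ((λ _ → yes tt) ∩? isCanon?) (λ h r → canon (h ∙ r))
                  act-ε act-∙ act-T public

      canon-ε-fixed : Fixed (canon ε)
      canon-ε-fixed h h∈H = sym (canon-cong (M⇒ε~ (∙-closed h∈H (ε~⇒M (~canon ε)))))

    -- A second coset rH fixed by H gives an element r ∉ H normalising H.
    opaque
      ∃-normaliser∉H : ∃[ r ] r ∉ H × (∀ h → h ∈ H → conj r h ∈ H)
      ∃-normaliser∉H
        with another-fixed-point (cosets-even H-subgroup ⊤-subgroup (λ _ → tt) tt (proj₂ outside))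
                                 (tt , canon-isCanon ε) canon-ε-fixed
        where open LeftMultiplicationOnCosets
      ... | r , ((_ , canon-r) , fixed-r) , r≢canon-ε = r , r∉H , normalises
        where
        r∉H : r ∉ H
        r∉H r∈H = r≢canon-ε (trans (sym canon-r) (sym (canon-cong (M⇒ε~ r∈H))))
        normalises : ∀ h → h ∈ H → conj r h ∈ H
        normalises h h∈H = subst (λ u → conj r u ∈ H) (⁻¹-involutive h)
          (subst (_∈ H) (cong (_∙ r) (⁻¹-anti-homo-∙ (h ⁻¹) r))
            (canon≡⇒~ (trans (fixed-r (h ⁻¹) (⁻¹-closed h∈H)) (sym canon-r))))

    H-normal : IsNormal (_∈ H)
    H-normal g {x} = normaliser-all g x
      where
      Normalises : El G → Set
      Normalises g = ∀ h → h ∈ H → conj g h ∈ H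
      normaliser : IsDecSubgroup Normalises
      normaliser = isDecSubgroup (λ g → all? (λ h → (h ∈? H) →-dec (conj g h ∈? H)))
        (λ h h∈H → subst (_∈ H) (sym (conj-by-ε h)) h∈H)
        (λ {a} {b} Na Nb h h∈H → subst (_∈ H) (sym (conj-∙ˡ a b h)) (Nb _ (Na h h∈H)))
      normaliser-all : ∀ g → Normalises g
      normaliser-all = maximality normaliser (λ g∈H h h∈H → ∙-closed (∙-closed (⁻¹-closed g∈H) h∈H) g∈H)
        (proj₂ (proj₂ ∃-normaliser∉H)) (proj₁ (proj₂ ∃-normaliser∉H))

    open NormalSubgroup G H-subgroup H-normal using (∃-square∈M; M∪zM; M∪zM-subgroup; ~∙~)

    opaque
      ∃-square∈H : ∃[ r ] r ∉ H × (r ∙ r) ∈ H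
      ∃-square∈H =
        let r , _ , r∉H , rr∈H = ∃-square∈M (λ _ → yes tt) (λ _ _ → tt) (λ _ → tt) tt
                                    (cosets-even H-subgroup ⊤-subgroup (λ _ → tt) tt (proj₂ outside))
        in r , r∉H , rr∈H

    r : El G
    r = proj₁ ∃-square∈H

    H∪rH : ∀ x → M∪zM r x
    H∪rH = maximality (M∪zM-subgroup (proj₂ (proj₂ ∃-square∈H))) inj₁ (inj₂ ~-refl) (proj₁ (proj₂ ∃-square∈H))

    ∉∙∉⇒∈ : ∀ {a b} → a ∉ H → b ∉ H → (a ∙ b) ∈ H
    ∉∙∉⇒∈ {a} {b} a∉H b∉H with H∪rH a | H∪rH b
    ... | inj₁ a∈H | _        = contradiction a∈H a∉H
    ... | _        | inj₁ b∈H = contradiction b∈H b∉H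
    ... | inj₂ r~a | inj₂ r~b = ~∙~ (proj₂ (proj₂ ∃-square∈H)) r~a r~b

    χ-hom : ∀ a b → χ (a ∙ b) ≡ χ a xor χ b
    χ-hom a b = χ-∙ (λ _ _ → ∉∙∉⇒∈) tt tt

  record NormalInG′ : Set₁ where
    field
      M          : El G → Set
      M-subgroup : IsDecSubgroup M
      M-normal   : IsNormal M
      M⊆G′       : ∀ {x} → M x → G′ G x

    M? : Decidable M
    M? = IsDecSubgroup.dec M-subgroup

  open NormalInG′ using (M?)

  ProperInG′ : NormalInG′ → Set
  ProperInG′ N = ∃[ y ] G′ G y × ¬ NormalInG′.M N y

  record IndexTwo (N : NormalInG′) : Set where
    field
      z       : El G
      z∈G′    : G′ G z
      z∉M     : ¬ NormalInG′.M N z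
      zz∈M    : NormalInG′.M N (z ∙ z)
      G′⊆M∪zM : ∀ {x} → G′ G x → NormalInG′.M N x ⊎ Cosets._~_ (NormalInG′.M-subgroup N) z x

  module _ (N : NormalInG′) where

    open NormalInG′ N hiding (M?)
    open IsDecSubgroup M-subgroup using (ε-closed; ∙-closed; ⁻¹-closed)
    open Cosets M-subgroup
    open NormalSubgroup G M-subgroup M-normal

    Central : El G → Set
    Central x = ∀ g → x ~ conj g x

    central? : Decidable Central
    central? x = all? (λ g → x ~? conj g x)

    G′-resp-~ : ∀ {x y} → x ~ y → G′ G x → G′ G y
    G′-resp-~ {x} {y} x~y G′x = subst (G′ G) (\\-leftDividesˡ x y) (mul G′x (M⊆G′ x~y))

    module ConjugationOnCosets where

      act : El G → El G → El G
      act g r = canon (conj (g ⁻¹) r)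

      act-ε : ∀ {r} → G′ G r × IsCanon r → act ε r ≡ r
      act-ε {r} (_ , canon-r) =
        trans (cong (λ u → canon (conj u r)) ε⁻¹≈ε) (trans (cong canon (conj-by-ε r)) canon-r)

      act-∙ : ∀ g h {r} → ⊤ → ⊤ → G′ G r × IsCanon r → act (g ∙ h) r ≡ act g (act h r)
      act-∙ g h {r} _ _ _ = canon-cong (subst (_~ conj (g ⁻¹) (act h r))
        (trans (sym (conj-∙ˡ (h ⁻¹) (g ⁻¹) r)) (cong (λ u → conj u r) (sym (⁻¹-anti-homo-∙ g h))))
        (~-conj (g ⁻¹) (~canon (conj (h ⁻¹) r))))

      act-T : ∀ g {r} → ⊤ → G′ G r × IsCanon r → G′ G (act g r) × IsCanon (act g r)
      act-T g {r} _ (G′r , _) = G′-resp-~ (~canon _) (G′-normal (g ⁻¹) G′r) , canon-isCanon _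

      open Action ⊤-subgroup {k} (|M|∣2^k ⊤-subgroup) (G′? ∩? isCanon?) act act-ε act-∙ act-T public

      fixed⇒central : ∀ {r} → (G′ G r × IsCanon r) × Fixed r → (G′ G r × Central r) × IsCanon r
      fixed⇒central {r} ((G′r , canon-r) , fixed-r) = (G′r , central) , canon-r
        where
        central : Central r
        central g = ~-sym (canon≡⇒~ (trans (subst (λ u → canon (conj u r) ≡ r) (⁻¹-involutive g) (fixed-r (g ⁻¹) tt))
                                           (sym canon-r)))

      central⇒fixed : ∀ {r} → (G′ G r × Central r) × IsCanon r → (G′ G r × IsCanon r) × Fixed r
      central⇒fixed {r} ((G′r , central-r) , canon-r) =
        (G′r , canon-r) , λ g _ → trans (canon-cong (~-sym (central-r (g ⁻¹)))) canon-r

    opaque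
      ∃-central-square : ProperInG′ N → ∃[ z ] (G′ G z × Central z) × ¬ M z × M (z ∙ z)
      ∃-central-square (y , G′y , ¬My) =
        ∃-square∈M (G′? ∩? central?) resp-~ ⁻¹-closed′ (one , ε-central) (subst (2 ∣_) fixed≡central 2∣fixed)
        where
        open ConjugationOnCosets
        2∣fixed : 2 ∣ count ((G′? ∩? isCanon?) ∩? fixed?)
        2∣fixed = fixed-points-even (cosets-even M-subgroup G′-subgroup M⊆G′ G′y ¬My)
        fixed≡central : count ((G′? ∩? isCanon?) ∩? fixed?) ≡ count ((G′? ∩? central?) ∩? isCanon?)
        fixed≡central =
          count-cong ((G′? ∩? isCanon?) ∩? fixed?) ((G′? ∩? central?) ∩? isCanon?) fixed⇒central central⇒fixed
        resp-~ : ∀ {x y} → x ~ y → G′ G x × Central x → G′ G y × Central y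
        resp-~ x~y (G′x , central-x) =
          G′-resp-~ x~y G′x , λ g → ~-trans (~-sym x~y) (~-trans (central-x g) (~-conj g x~y))
        ⁻¹-closed′ : ∀ {x} → G′ G x × Central x → G′ G (x ⁻¹) × Central (x ⁻¹)
        ⁻¹-closed′ {x} (G′x , central-x) =
          inv G′x , λ g → subst (x ⁻¹ ~_) (sym (conj-⁻¹ g x)) (~-⁻¹ (central-x g))
        ε-central : Central ε
        ε-central g = subst (ε ~_) (sym (conj-ε g)) ~-refl

    enlarge : ProperInG′ N → IndexTwo N ⊎ ∃[ N′ ] ProperInG′ N′ × count (M? N) < count (M? N′)
    enlarge proper with ∃-central-square proper
    ... | z , (G′z , central-z) , ¬Mz , Mzz with any? (λ x → G′? x ×-dec ¬? (M? N x ⊎-dec (z ~? x)))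
    ...   | no ∄x = inj₁ record
      { z = z ; z∈G′ = G′z ; z∉M = ¬Mz ; zz∈M = Mzz
      ; G′⊆M∪zM = λ {x} G′x → decidable-stable (M? N x ⊎-dec (z ~? x)) (λ ¬N′x → ∄x (x , G′x , ¬N′x)) }
    ...   | yes (x , G′x , ¬N′x) = inj₂ (N′ , (x , G′x , ¬N′x) , |M|<|N′|)
      where
      |M|<|N′| : count (M? N) < count (M? N ∪? (z ~?_))
      |M|<|N′| = count-mono-< (M? N) (M? N ∪? (z ~?_)) inj₁ ¬Mz (inj₂ ~-refl)
      N′ : NormalInG′
      N′ = record
        { M = M∪zM z ; M-subgroup = M∪zM-subgroup Mzz ; M-normal = M∪zM-normal central-z
        ; M⊆G′ = λ { (inj₁ Mx) → M⊆G′ Mx ; (inj₂ z~x) → G′-resp-~ z~x G′z } }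

  trivial : NormalInG′
  trivial = record
    { M = _≡ ε
    ; M-subgroup = record
      { dec = _≟ ε ; ε-closed = refl
      ; ∙-closed = λ { refl refl → identityˡ ε } ; ⁻¹-closed = λ { refl → ε⁻¹≈ε } }
    ; M-normal = λ { g refl → conj-ε g }
    ; M⊆G′ = λ { refl → one } }

  -- Starting from the trivial subgroup, enlarge M by one central coset of order two at a time.
  opaque
    G′-trivial⊎index-two : G′trivial G ⊎ Σ NormalInG′ IndexTwo
    G′-trivial⊎index-two with any? (λ x → G′? x ×-dec ¬? (x ≟ ε))
    ... | no ∄x = inj₁ λ x G′x → decidable-stable (x ≟ ε) (λ x≢ε → ∄x (x , G′x , x≢ε))
    ... | yes G′-nontrivial = inj₂ (proj₁ (proj₁ final) , proj₂ final)
      where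
      State : Set₁
      State = Σ NormalInG′ ProperInG′
      size : State → ℕ
      size (N , _) = count (M? N)
      step : ∀ s → IndexTwo (proj₁ s) ⊎ ∃[ s′ ] size s < size s′
      step (N , proper) with enlarge N proper
      ... | inj₁ index-two = inj₁ index-two
      ... | inj₂ (N′ , proper′ , bigger) = inj₂ ((N′ , proper′) , bigger)
      final : Σ State (IndexTwo ∘ proj₁)
      final = bounded-ascent size order (λ s → count-≤ (M? (proj₁ s))) step (trivial , G′-nontrivial)

F₂³ : Set
F₂³ = Bool × Bool × Bool

0³ : F₂³
0³ = false , false , false

_≟³_ : (u w : F₂³) → Dec (u ≡ w)
_≟³_ = ≡-dec Bool._≟_ (≡-dec Bool._≟_ Bool._≟_)

_+³_ : F₂³ → F₂³ → F₂³
(a , b , c) +³ (d , e , f) = a xor d , b xor e , c xor f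

_·_ : F₂³ → F₂³ → Bool
(u₀ , u₁ , u₂) · (f₀ , f₁ , f₂) = ((u₀ ∧ f₀) xor (u₁ ∧ f₁)) xor (u₂ ∧ f₂)

·-distribʳ-+³ : ∀ u w f → (u +³ w) · f ≡ (u · f) xor (w · f)
·-distribʳ-+³ (a , b , c) (d , e , g) (f₀ , f₁ , f₂) =
  solve 9 (λ a b c d e g f₀ f₁ f₂ → ((a :+ d) :* f₀ :+ (b :+ e) :* f₁) :+ (c :+ g) :* f₂
                                  := ((a :* f₀ :+ b :* f₁) :+ c :* f₂) :+ ((d :* f₀ :+ e :* f₁) :+ g :* f₂))
        refl a b c d e g f₀ f₁ f₂
  where open xor-∧-Solver

·-zeroʳ : ∀ u → u · 0³ ≡ false
·-zeroʳ (a , b , c) rewrite Bool.∧-zeroʳ a | Bool.∧-zeroʳ b | Bool.∧-zeroʳ c = refl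

-- The alternating form on F₂³ whose Gram matrix has off-diagonal entries b = (b₀₁ , b₀₂ , b₁₂).
form : F₂³ → F₂³ → F₂³ → Bool
form (b₀₁ , b₀₂ , b₁₂) u w =
  u · (w · (false , b₀₁ , b₀₂) , w · (b₀₁ , false , b₁₂) , w · (b₀₂ , b₁₂ , false))

NonVanishingOnKernel : F₂³ → F₂³ → Set
NonVanishingOnKernel b f = ∃[ u ] ∃[ w ] u · f ≡ false × w · f ≡ false × form b u w ≡ true

Configuration : F₂³ → F₂³ → F₂³ → F₂³ → Set
Configuration b f₁ f₂ f₃ = f₃ ≢ 0³ × f₁ ≢ f₂ × f₁ ≢ f₃ × f₂ ≢ f₃ ×
  (∀ u → u · f₁ ≡ false → u · f₂ ≡ false → u · f₃ ≡ false) ×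
  NonVanishingOnKernel b f₁ × NonVanishingOnKernel b f₂ × NonVanishingOnKernel b f₃

∀ᵇ? : {P : Bool → Set} → Decidable P → Dec (∀ b → P b)
∀ᵇ? P? = map′ (λ { (p , q) false → p ; (p , q) true → q }) (λ h → h false , h true) (P? false ×-dec P? true)

∃ᵇ? : {P : Bool → Set} → Decidable P → Dec (∃ P)
∃ᵇ? P? = map′ (λ { (inj₁ p) → false , p ; (inj₂ q) → true , q })
              (λ { (false , p) → inj₁ p ; (true , q) → inj₂ q })
              (P? false ⊎-dec P? true)

∀³? : {P : F₂³ → Set} → Decidable P → Dec (∀ u → P u)
∀³? P? = map′ (λ h (a , b , c) → h a b c) (λ h a b c → h (a , b , c))
              (∀ᵇ? λ a → ∀ᵇ? λ b → ∀ᵇ? λ c → P? (a , b , c))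

∃³? : {P : F₂³ → Set} → Decidable P → Dec (∃ P)
∃³? P? = map′ (λ { (a , b , c , p) → (a , b , c) , p }) (λ { ((a , b , c) , p) → a , b , c , p })
              (∃ᵇ? λ a → ∃ᵇ? λ b → ∃ᵇ? λ c → P? (a , b , c))

configuration? : ∀ b f₁ f₂ f₃ → Dec (Configuration b f₁ f₂ f₃)
configuration? b f₁ f₂ f₃ =
  ¬? (f₃ ≟³ 0³) ×-dec ¬? (f₁ ≟³ f₂) ×-dec ¬? (f₁ ≟³ f₃) ×-dec ¬? (f₂ ≟³ f₃) ×-dec
  ∀³? (λ u → (u · f₁ Bool.≟ false) →-dec (u · f₂ Bool.≟ false) →-dec (u · f₃ Bool.≟ false)) ×-dec
  nonVanishing? f₁ ×-dec nonVanishing? f₂ ×-dec nonVanishing? f₃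
  where
  nonVanishing? : ∀ f → Dec (NonVanishingOnKernel b f)
  nonVanishing? f = ∃³? λ u → ∃³? λ w →
    (u · f Bool.≟ false) ×-dec (w · f Bool.≟ false) ×-dec (form b u w Bool.≟ true)

no-configuration : ∀ b f₁ f₂ f₃ → ¬ Configuration b f₁ f₂ f₃
no-configuration = from-yes (∀³? λ b → ∀³? λ f₁ → ∀³? λ f₂ → ∀³? λ f₃ → ¬? (configuration? b f₁ f₂ f₃))

xor≡false⇒≡ : ∀ a b → a xor b ≡ false → a ≡ b
xor≡false⇒≡ false false _  = refl
xor≡false⇒≡ true  true  _  = refl
xor≡false⇒≡ false true  ()
xor≡false⇒≡ true  false ()

module Abelianisation (G : FinGroup) (g : Fin 3 → El G) (generates : GeneratesAbelianization G 3 g) where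

  open FinGroup G
  open GroupTheory G

  Gens : El G → Set
  Gens z = (∃[ i ] z ≡ g i) ⊎ G′ G z

  basis : Fin 3 → F₂³
  basis zero             = true  , false , false
  basis (suc zero)       = false , true  , false
  basis (suc (suc zero)) = false , false , true

  coords : ∀ {x} → ⟨_⟩ G Gens x → F₂³
  coords (gen (inj₁ (i , _))) = basis i
  coords (gen (inj₂ _))       = 0³
  coords one                  = 0³
  coords (mul p q)            = coords p +³ coords q
  coords (inv p)              = coords p

  values : (El G → Bool) → F₂³
  values φ = φ (g zero) , φ (g (suc zero)) , φ (g (suc (suc zero)))

  basis·values : ∀ φ i → basis i · values φ ≡ φ (g i)
  basis·values φ zero             = trans (Bool.xor-identityʳ _) (Bool.xor-identityʳ _)
  basis·values φ (suc zero)       = Bool.xor-identityʳ _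
  basis·values φ (suc (suc zero)) = refl

  pick : Bool → El G → El G
  pick true  x = x
  pick false _ = ε

  realise : F₂³ → El G
  realise (a , b , c) = (pick a (g zero) ∙ pick b (g (suc zero))) ∙ pick c (g (suc (suc zero)))

  IsHom : (El G → Bool) → Set
  IsHom φ = ∀ x y → φ (x ∙ y) ≡ φ x xor φ y

  module Hom {φ : El G → Bool} (φ-∙ : IsHom φ) where

    φ-ε : φ ε ≡ false
    φ-ε = trans (cong φ (sym (identityˡ ε))) (trans (φ-∙ ε ε) (Bool.xor-same (φ ε)))

    φ-⁻¹ : ∀ x → φ (x ⁻¹) ≡ φ x
    φ-⁻¹ x = xor≡false⇒≡ _ _ (trans (sym (φ-∙ (x ⁻¹) x)) (trans (cong φ (inverseˡ x)) φ-ε))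

    φ-G′ : ∀ {x} → G′ G x → φ x ≡ false
    φ-G′ = ⟨⟩-minimal {P = λ x → φ x ≡ false} φ-ε (λ {x} {y} p q → trans (φ-∙ x y) (cong₂ _xor_ p q))
                      (λ {x} p → trans (φ-⁻¹ x) p) φ-⁅,⁆
      where
      φ-⁅,⁆ : ∀ {c} → ∃[ a ] ∃[ b ] ⊤ × ⊤ × c ≡ ⁅ a , b ⁆ → φ c ≡ false
      φ-⁅,⁆ (a , b , _ , _ , refl) = begin
        φ ⁅ a , b ⁆                          ≡⟨ φ-∙ _ _ ⟩
        φ ((a ⁻¹) ∙ (b ⁻¹)) xor φ (a ∙ b)   ≡⟨ cong₂ _xor_ (trans (φ-∙ _ _) (cong₂ _xor_ (φ-⁻¹ a) (φ-⁻¹ b)))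
                                                           (φ-∙ a b) ⟩
        (φ a xor φ b) xor (φ a xor φ b)     ≡⟨ Bool.xor-same (φ a xor φ b) ⟩
        false                               ∎
        where open ≡-Reasoning

    φ≡coords·values : ∀ {x} (d : ⟨_⟩ G Gens x) → φ x ≡ coords d · values φ
    φ≡coords·values (gen (inj₁ (i , refl))) = sym (basis·values φ i)
    φ≡coords·values (gen (inj₂ G′x))        = φ-G′ G′x
    φ≡coords·values one                     = φ-ε
    φ≡coords·values (mul {x} {y} p q)       = trans (φ-∙ x y)
      (trans (cong₂ _xor_ (φ≡coords·values p) (φ≡coords·values q))
             (sym (·-distribʳ-+³ (coords p) (coords q) (values φ))))
    φ≡coords·values (inv {x} p)             = trans (φ-⁻¹ x) (φ≡coords·values p)

    φ-pick : ∀ a x → φ (pick a x) ≡ a ∧ φ x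
    φ-pick true  x = refl
    φ-pick false x = φ-ε

    φ-realise : ∀ u → φ (realise u) ≡ u · values φ
    φ-realise (a , b , c) =
      trans (φ-∙ _ _) (cong₂ _xor_ (trans (φ-∙ _ _) (cong₂ _xor_ (φ-pick a _) (φ-pick b _))) (φ-pick c _))

  module Form {M : El G → Set} (M-subgroup : IsDecSubgroup M) (M-normal : IsNormal M) {z : El G}
              (zz∈M : M (z ∙ z)) (G′⊆M∪zM : ∀ {x} → G′ G x → M x ⊎ Cosets._~_ M-subgroup z x) where

    open IsDecSubgroup M-subgroup using (ε-closed; ⁻¹-closed)
    open Cosets M-subgroup using (χ; χ-∙; χ-∈; χ-cong)
    open NormalSubgroup G M-subgroup M-normal using (~∙~)

    β : El G → El G → Bool
    β x y = χ ⁅ x , y ⁆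

    χ-∙-G′ : ∀ {a b} → G′ G a → G′ G b → χ (a ∙ b) ≡ χ a xor χ b
    χ-∙-G′ = χ-∙ ∉∙∉⇒∈
      where
      ∉∙∉⇒∈ : ∀ {a b} → G′ G a → G′ G b → ¬ M a → ¬ M b → M (a ∙ b)
      ∉∙∉⇒∈ G′a G′b ¬Ma ¬Mb with G′⊆M∪zM G′a | G′⊆M∪zM G′b
      ... | inj₁ Ma  | _        = contradiction Ma ¬Ma
      ... | _        | inj₁ Mb  = contradiction Mb ¬Mb
      ... | inj₂ z~a | inj₂ z~b = ~∙~ zz∈M z~a z~b

    G′-⁅,⁆ : ∀ a b → G′ G ⁅ a , b ⁆
    G′-⁅,⁆ a b = gen (a , b , tt , tt , refl)

    β-sym : ∀ x y → β y x ≡ β x y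
    β-sym x y = trans (cong χ (sym (⁅,⁆-⁻¹ x y))) (χ-cong (subst M (⁻¹-involutive _) ∘ ⁻¹-closed) ⁻¹-closed)

    β-self : ∀ x → β x x ≡ false
    β-self x = trans (cong χ (⁅,⁆-self x)) (χ-∈ ε-closed)

    β-∙ʳ : ∀ x y w → β x (y ∙ w) ≡ β x w xor β x y
    β-∙ʳ x y w = trans (cong χ (⁅,⁆-∙ʳ x y w)) (trans (χ-∙-G′ (G′-⁅,⁆ x w) (G′-normal w (G′-⁅,⁆ x y)))
      (cong (β x w xor_) (χ-cong (subst M (conj-inverse w _) ∘ M-normal (w ⁻¹)) (M-normal w))))

    β-hom : ∀ y → IsHom (λ x → β x y)
    β-hom y x w = trans (sym (β-sym (x ∙ w) y))
      (trans (β-∙ʳ y x w) (trans (cong₂ _xor_ (β-sym w y) (β-sym x y)) (Bool.xor-comm (β w y) (β x y))))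

    gram : F₂³
    gram = β (g zero) (g (suc zero)) , β (g zero) (g (suc (suc zero))) , β (g (suc zero)) (g (suc (suc zero)))

    β≡form : ∀ {x y} (dx : ⟨_⟩ G Gens x) (dy : ⟨_⟩ G Gens y) → β x y ≡ form gram (coords dx) (coords dy)
    β≡form {x} {y} dx dy = trans (Hom.φ≡coords·values (β-hom y) dx)
      (cong (coords dx ·_) (cong₂ _,_ (column zero) (cong₂ _,_ (column (suc zero)) (column (suc (suc zero))))))
      where
      gram-column : Fin 3 → F₂³
      gram-column zero             = false , proj₁ gram , proj₁ (proj₂ gram)
      gram-column (suc zero)       = proj₁ gram , false , proj₂ (proj₂ gram)
      gram-column (suc (suc zero)) = proj₁ (proj₂ gram) , proj₂ (proj₂ gram) , false
      values-column : ∀ i → values (λ t → β t (g i)) ≡ gram-column i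
      values-column zero             = cong₂ _,_ (β-self _) (cong₂ _,_ (β-sym _ _) (β-sym _ _))
      values-column (suc zero)       = cong₂ _,_ refl (cong₂ _,_ (β-self _) (β-sym _ _))
      values-column (suc (suc zero)) = cong₂ _,_ refl (cong₂ _,_ refl (β-self _))
      column : ∀ i → β (g i) y ≡ coords dy · gram-column i
      column i = trans (sym (β-sym (g i) y))
        (trans (Hom.φ≡coords·values (β-hom (g i)) dy) (cong (coords dy ·_) (values-column i)))

module ThreeMaximalSubgroups (G : FinGroup) {k : ℕ} (order≡2^k : FinGroup.order G ≡ 2 ^ k)
                             (g : Fin 3 → El G) (generates : GeneratesAbelianization G 3 g) where

  open FinGroup G
  open GroupTheory G
  open TwoGroup G {k} order≡2^k
  open Abelianisation G g generates

  module _ (N : NormalInG′) (index-two : IndexTwo N) where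

    open NormalInG′ N
    open IsDecSubgroup M-subgroup using (ε-closed; ∙-closed; ⁻¹-closed)
    open IndexTwo index-two
    open Cosets M-subgroup using (χ-∉)
    open Form M-subgroup M-normal zz∈M G′⊆M∪zM

    module Kernel (H : Subset order) (H-maximal : IsMaximalSubgroup G H) where

      open Maximal H H-maximal using (H-subgroup; χ-hom; outside)
      open Cosets H-subgroup using ()
        renaming (χ to χᴴ; χ-∈ to χᴴ-∈; χ-∉ to χᴴ-∉; χ≡false⇒∈ to χᴴ≡false⇒∈)
      open Hom {χᴴ} χ-hom using (φ≡coords·values; φ-realise)

      f : F₂³
      f = values χᴴ

      χᴴ≡coords·f : ∀ x → χᴴ x ≡ coords (generates x) · f
      χᴴ≡coords·f x = φ≡coords·values (generates x)

      ∈⇒coords·f : ∀ {x} → x ∈ H → coords (generates x) · f ≡ false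
      ∈⇒coords·f {x} x∈H = trans (sym (χᴴ≡coords·f x)) (χᴴ-∈ x∈H)

      coords·f⇒∈ : ∀ {x} → coords (generates x) · f ≡ false → x ∈ H
      coords·f⇒∈ {x} coords·f≡false = χᴴ≡false⇒∈ (trans (χᴴ≡coords·f x) coords·f≡false)

      ·f⇒realise-∈ : ∀ u → u · f ≡ false → realise u ∈ H
      ·f⇒realise-∈ u u·f≡false = χᴴ≡false⇒∈ (trans (φ-realise u) u·f≡false)

      realise-∈⇒·f : ∀ u → realise u ∈ H → u · f ≡ false
      realise-∈⇒·f u realise-u∈H = trans (sym (φ-realise u)) (χᴴ-∈ realise-u∈H)

      f≢0³ : f ≢ 0³
      f≢0³ f≡0³ = contradiction (coords·f⇒∈ coords·f≡false) y∉H
        where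
        y = proj₁ outside
        y∉H = proj₂ outside
        coords·f≡false : coords (generates y) · f ≡ false
        coords·f≡false = trans (cong (coords (generates y) ·_) f≡0³) (·-zeroʳ (coords (generates y)))

      -- If every commutator of elements of H lay in M, then H′ ⊆ M; but z ∈ G′ = H′ lies outside M.
      non-vanishing : _≐_ G (derived G (mem G H)) (G′ G) → NonVanishingOnKernel gram f
      non-vanishing H′≐G′ with any? (λ a → any? (λ b → (a ∈? H) ×-dec (b ∈? H) ×-dec ¬? (M? ⁅ a , b ⁆)))
      ... | yes (a , b , a∈H , b∈H , ⁅a,b⁆∉M) =
        coords (generates a) , coords (generates b) , ∈⇒coords·f a∈H , ∈⇒coords·f b∈H ,
        trans (sym (β≡form (generates a) (generates b))) (χ-∉ ⁅a,b⁆∉M)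
      ... | no ∄a,b = contradiction (H′⊆M (proj₂ H′≐G′ z z∈G′)) z∉M
        where
        H-commutator∈M : ∀ {c} → ∃[ a ] ∃[ b ] a ∈ H × b ∈ H × c ≡ ⁅ a , b ⁆ → M c
        H-commutator∈M (a , b , a∈H , b∈H , refl) =
          decidable-stable (M? _) (λ ⁅a,b⁆∉M → ∄a,b (a , b , a∈H , b∈H , ⁅a,b⁆∉M))
        H′⊆M : ∀ {x} → derived G (mem G H) x → M x
        H′⊆M = ⟨⟩-minimal ε-closed ∙-closed ⁻¹-closed H-commutator∈M

    f-injective : ∀ {H₁ H₂} (H₁-maximal : IsMaximalSubgroup G H₁) (H₂-maximal : IsMaximalSubgroup G H₂) →
                  Kernel.f H₁ H₁-maximal ≡ Kernel.f H₂ H₂-maximal → _≐_ G (mem G H₁) (mem G H₂)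
    f-injective {H₁} {H₂} H₁-maximal H₂-maximal f₁≡f₂ =
      (λ x x∈H₁ → K₂.coords·f⇒∈ (subst (in-kernel x) f₁≡f₂ (K₁.∈⇒coords·f x∈H₁))) ,
      (λ x x∈H₂ → K₁.coords·f⇒∈ (subst (in-kernel x) (sym f₁≡f₂) (K₂.∈⇒coords·f x∈H₂)))
      where
      in-kernel : El G → F₂³ → Set
      in-kernel x f = coords (generates x) · f ≡ false
      module K₁ = Kernel H₁ H₁-maximal
      module K₂ = Kernel H₂ H₂-maximal

    kernel-inclusion : ∀ {H₁ H₂ H₃} (H₁-maximal : IsMaximalSubgroup G H₁) (H₂-maximal : IsMaximalSubgroup G H₂)
                       (H₃-maximal : IsMaximalSubgroup G H₃) → _⊆_ G (λ x → mem G H₁ x × mem G H₂ x) (mem G H₃) →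
                       ∀ u → u · Kernel.f H₁ H₁-maximal ≡ false → u · Kernel.f H₂ H₂-maximal ≡ false →
                       u · Kernel.f H₃ H₃-maximal ≡ false
    kernel-inclusion {H₁} {H₂} {H₃} H₁-maximal H₂-maximal H₃-maximal H₁∩H₂⊆H₃ u u·f₁≡false u·f₂≡false =
      Kernel.realise-∈⇒·f H₃ H₃-maximal u (H₁∩H₂⊆H₃ (realise u)
        (Kernel.·f⇒realise-∈ H₁ H₁-maximal u u·f₁≡false , Kernel.·f⇒realise-∈ H₂ H₂-maximal u u·f₂≡false))

  G′-trivial : (H₁ H₂ H₃ : Subset order) →
      IsMaximalSubgroup G H₁ → IsMaximalSubgroup G H₂ → IsMaximalSubgroup G H₃ →
      ¬ (_≐_ G (mem G H₁) (mem G H₂)) → ¬ (_≐_ G (mem G H₁) (mem G H₃)) → ¬ (_≐_ G (mem G H₂) (mem G H₃)) →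
      _⊆_ G (λ x → mem G H₁ x × mem G H₂ x) (mem G H₃) →
      _≐_ G (derived G (mem G H₁)) (G′ G) → _≐_ G (derived G (mem G H₂)) (G′ G) →
      _≐_ G (derived G (mem G H₃)) (G′ G) →
      G′trivial G
  G′-trivial H₁ H₂ H₃ m₁ m₂ m₃ H₁≉H₂ H₁≉H₃ H₂≉H₃ H₁∩H₂⊆H₃ H₁′≐G′ H₂′≐G′ H₃′≐G′
    with G′-trivial⊎index-two
  ... | inj₁ G′-trivial = G′-trivial
  ... | inj₂ (N , index-two) = ⊥-elim (no-configuration _ _ _ _
        ( K₃.f≢0³
        , H₁≉H₂ ∘ f-injective N index-two m₁ m₂ , H₁≉H₃ ∘ f-injective N index-two m₁ m₃
        , H₂≉H₃ ∘ f-injective N index-two m₂ m₃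
        , kernel-inclusion N index-two m₁ m₂ m₃ H₁∩H₂⊆H₃
        , K₁.non-vanishing H₁′≐G′ , K₂.non-vanishing H₂′≐G′ , K₃.non-vanishing H₃′≐G′ ))
    where
    module K₁ = Kernel N index-two H₁ m₁
    module K₂ = Kernel N index-two H₂ m₂
    module K₃ = Kernel N index-two H₃ m₃

proposition10 : (G : FinGroup) → Is2Group G → AbelianizationRank G 3 →
    ((H₁ H₂ H₃ : Subset (FinGroup.order G)) →
      IsMaximalSubgroup G H₁ → IsMaximalSubgroup G H₂ → IsMaximalSubgroup G H₃ →
      ¬ (_≐_ G (mem G H₁) (mem G H₂)) → ¬ (_≐_ G (mem G H₁) (mem G H₃)) →
      ¬ (_≐_ G (mem G H₂) (mem G H₃)) →
      _⊆_ G (λ x → mem G H₁ x × mem G H₂ x) (mem G H₃) →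
      _≐_ G (derived G (mem G H₁)) (G′ G) →
      _≐_ G (derived G (mem G H₂)) (G′ G) →
      _≐_ G (derived G (mem G H₃)) (G′ G) →
      G′trivial G ×
        ((H : Subset (FinGroup.order G)) → IsSubgroup G H →
          _≐_ G (derived G (mem G H)) (G′ G)))
    × (G′trivial G →
        (H : Subset (FinGroup.order G)) → IsSubgroup G H →
          _≐_ G (derived G (mem G H)) (G′ G))
proposition10 G (k , order≡2^k) ((g , generates) , _) =
  (λ H₁ H₂ H₃ m₁ m₂ m₃ n₁₂ n₁₃ n₂₃ H₁∩H₂⊆H₃ d₁ d₂ d₃ →
     let G′-trivial = ThreeMaximalSubgroups.G′-trivial G {k} order≡2^k g generates
                        H₁ H₂ H₃ m₁ m₂ m₃ n₁₂ n₁₃ n₂₃ H₁∩H₂⊆H₃ d₁ d₂ d₃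
     in G′-trivial , G′trivial⇒derived≐G′ G′-trivial)
  , G′trivial⇒derived≐G′
  where open GroupTheory G using (G′trivial⇒derived≐G′)
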